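{- Let $n\ge2$ be even. For $z\in\tilde I^{\mathsf{FPF}}_n$ and $i\in\mathbb Z$, $$\hat\ell_{\mathsf{FPF}}(s_izs_i)=\begin{cases}\hat\ell_{\mathsf{FPF}}(z)-1&\text{if } z(i)>z(i+1)\ne i,\\ \hat\ell_{\mathsf{FPF}}(z)&\text{if } z(i)=i+1,\\ \hat\ell_{\mathsf{FPF}}(z)+1&\text{if } z(i)<z(i+1).\end{cases}$$
   Context: $\tilde S_n$ is the group of bijections $\pi:\mathbb Z\to\mathbb Z$ with $\pi(i+n)=\pi(i)+n$ and $\sum_{i=1}^n\pi(i)=\sum_{i=1}^n i$, a Coxeter group with generators $s_1,\dots,s_n$ ($s_i$, $i\in\mathbb Z$, swaps $i+kn,i+1+kn$ for all $k$ and fixes other integers; $s_{i+n}=s_i$) and length $\ell$. $\tilde I^{\mathsf{FPF}}_n$ is the set of $z\in\tilde S_n$ with $z(z(i))=i\ne z(i)$ for all $i$, and $\hat\ell_{\mathsf{FPF}}(z)=\frac12(\ell(z)-\frac n2)$. -}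

module Defs where

open import Data.Nat as ℕ using (ℕ; zero; suc)
open import Data.Integer as ℤ using (ℤ; +_; _+_; _-_; _%ℕ_)
open import Data.Fin using (Fin; toℕ)
open import Data.List using (List; []; _∷_; length)
open import Data.Product using (Σ; _×_; _,_)
open import Relation.Binary.PropositionalEquality using (_≡_; _≢_)
open import Relation.Nullary using (¬_)
open import Data.Bool using (if_then_else_)
import Data.Nat.Properties as ℕP
import Data.Rational.Unnormalised as Q

-- residue of an integer modulo n (only used for n ≥ 2; value for n = 0 irrelevant)
modN : ℕ → ℤ → ℕ
modN zero    x = 0
modN (suc m) x = x %ℕ suc m

-- the simple transposition s_i of ~S_n (i ∈ ℤ): swaps i+kn and i+1+kn for all k
s : (n : ℕ) → ℤ → ℤ → ℤ
s n i j =
  if modN n (j - i) ℕ.≡ᵇ 0 then j + + 1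
  else (if modN n (j - i) ℕ.≡ᵇ 1 then j - + 1 else j)

sumTo : ℕ → (ℤ → ℤ) → ℤ
sumTo zero    f = + 0
sumTo (suc k) f = sumTo k f + f (+ suc k)

record IsAffinePerm (n : ℕ) (π : ℤ → ℤ) : Set where
  field
    injective  : ∀ a b → π a ≡ π b → a ≡ b
    surjective : ∀ b → Σ ℤ (λ a → π a ≡ b)
    periodic   : ∀ i → π (i + + n) ≡ π i + + n
    windowSum  : sumTo n π ≡ sumTo n (λ i → i)

IsFPFInvolution : ℕ → (ℤ → ℤ) → Set
IsFPFInvolution n z = IsAffinePerm n z × (∀ i → z (z i) ≡ i × z i ≢ i)

-- product of a word s_{a_1} s_{a_2} ... s_{a_k} in the generators s_1,...,s_n
-- (letter a : Fin n stands for s_{toℕ a + 1})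
evalWord : (n : ℕ) → List (Fin n) → ℤ → ℤ
evalWord n []       j = j
evalWord n (a ∷ w)  j = s n (+ suc (toℕ a)) (evalWord n w j)

Represents : (n : ℕ) → List (Fin n) → (ℤ → ℤ) → Set
Represents n w π = ∀ j → evalWord n w j ≡ π j

HasLength : (n : ℕ) → (ℤ → ℤ) → ℕ → Set
HasLength n π k =
  Σ (List (Fin n)) (λ w → Represents n w π × length w ≡ k)
  × (∀ (w : List (Fin n)) → Represents n w π → k ℕ.≤ length w)

HasFPFLength : (n : ℕ) → (ℤ → ℤ) → Q.ℚᵘ → Set
HasFPFLength n z q =
  Σ ℕ (λ k → HasLength n z k × ((q Q.* (+ 2 Q./ 1)) Q.≃ (((+ k) - (+ (n ℕ./ 2))) Q./ 1)))

conj : (n : ℕ) → ℤ → (ℤ → ℤ) → ℤ → ℤ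
conj n i z j = s n i (z (s n i j))

-- By Shi's formula, the window inversion count
--   inversions w = Σ_{a,b ∈ [c, c+n)} |⌊(w b − w a)/n⌋ − ⌊(b − a)/n⌋|
-- equals 2ℓ(w) and does not depend on the window [c, c+n). Taking the window that starts at i,
-- right multiplication by s_i changes it by +2 when w(i) < w(i+1) and by −2 otherwise; with
-- inversions id = 0 this bounds ℓ from below, and following descents down to a descent-free
-- element (a translation with vanishing displacement sum, hence the identity) produces a word
-- of length inversions w / 2. So ℓ(w s_i) = ℓ(w) ± 1 according to the order of w(i), w(i+1).
--
-- For an involution z, s_i z s_i = (z s_i)⁻¹ s_i and ℓ((z s_i)⁻¹) = ℓ(z s_i), so the length
-- changes twice in the direction given by z(i), z(i+1): s_i preserves the order of z(i) and
-- z(i+1) unless z(i) ≡ i (mod n), or z(i+1) ≡ i and z(i) = z(i+1) + 1, which for a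
-- fixed-point-free involution forces z(i) = i resp. z(i+1) = i. If z(i) = i+1, s_i z s_i = z.

module Submission where

open import Defs
open import Data.Nat as ℕ using (ℕ; zero; suc)
open import Data.Integer as ℤ using (ℤ; +_; -[1+_]; _+_; _-_; _*_; -_; _≤_; _<_; ∣_∣; _%ℕ_; _/ℕ_)
open import Data.Product using (Σ; _×_; _,_; proj₁; proj₂)
open import Relation.Binary.PropositionalEquality hiding ([_])
import Data.Rational.Unnormalised as Q

import Data.Nat.Properties as ℕP
import Data.Nat.Tactic.RingSolver as ℕSolver
import Data.Integer.Properties as ℤP
open import Data.Integer.DivMod using (a≡a%ℕn+[a/ℕn]*n; n%ℕd<d)
open import Data.Integer.Tactic.RingSolver using (solve; solve-∀)
open import Data.Fin using (Fin; toℕ; fromℕ<)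
import Data.Fin.Properties as FinP
open import Data.List using (List; []; _∷_; _++_; [_]; reverse; length)
import Data.List.Properties as ListP
open import Data.Bool using (if_then_else_)
open import Data.Empty using (⊥-elim)
open import Algebra.Structures using (IsCommutativeMonoid)
open import Algebra.Properties.CommutativeSemigroup ℕP.+-commutativeSemigroup using (x∙yz≈y∙xz)
open import Relation.Nullary using (¬_; Dec; yes; no)
open import Relation.Binary.Definitions using (tri<; tri≈; tri>)

open ≡-Reasoning

≤⇒offset : ∀ {x y : ℤ} → x ≤ y → Σ ℕ λ k → y ≡ x + + k
≤⇒offset {x} {y} x≤y = ∣ y - x ∣ , (begin
  y               ≡⟨ solve (x ∷ y ∷ []) ⟩
  x + (y - x)     ≡⟨ cong (λ d → x + d) (sym (ℤP.0≤i⇒+∣i∣≡i (ℤP.i≤j⇒0≤j-i x≤y))) ⟩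
  x + + ∣ y - x ∣ ∎)

offset⇒≤ : ∀ {x y : ℤ} (k : ℕ) → y ≡ x + + k → x ≤ y
offset⇒≤ {x} k refl = ℤP.i≤i+j x (+ k)

<⇒offset : ∀ {x y : ℤ} → x < y → Σ ℕ λ k → y ≡ x + + 1 + + k
<⇒offset {x} x<y with ≤⇒offset (ℤP.i<j⇒suc[i]≤j x<y)
... | k , eq = k , trans eq (cong (_+ + k) (ℤP.+-comm (+ 1) x))

offset⇒< : ∀ {x y : ℤ} (k : ℕ) → y ≡ x + + 1 + + k → x < y
offset⇒< {x} k eq = ℤP.suc[i]≤j⇒i<j (offset⇒≤ k (trans eq (cong (_+ + k) (ℤP.+-comm x (+ 1)))))

+-suc : ∀ c k → c + + k + + 1 ≡ c + + suc k
+-suc c k = trans (ℤP.+-assoc c (+ k) (+ 1)) (cong (λ n → c + + n) (ℕP.+-comm k 1))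

+-cancelʳ : ∀ a b c → a + c ≡ b + c → a ≡ b
+-cancelʳ a b c e = begin
  a         ≡⟨ solve (a ∷ c ∷ []) ⟩
  a + c - c ≡⟨ cong (_- c) e ⟩
  b + c - c ≡⟨ solve (b ∷ c ∷ []) ⟩
  b         ∎

+1-shift-invariant⇒+shift-invariant : ∀ {A : Set} (g : ℤ → A) → (∀ c → g c ≡ g (c + + 1)) → ∀ c k → g c ≡ g (c + + k)
+1-shift-invariant⇒+shift-invariant g step c zero    = cong g (sym (ℤP.+-identityʳ c))
+1-shift-invariant⇒+shift-invariant g step c (suc k) =
  trans (+1-shift-invariant⇒+shift-invariant g step c k) (trans (step (c + + k)) (cong g (+-suc c k)))

+1-shift-invariant⇒constant : ∀ {A : Set} (g : ℤ → A) → (∀ c → g c ≡ g (c + + 1)) → ∀ c → g c ≡ g (+ 0)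
+1-shift-invariant⇒constant g step (+ k)    = sym (+1-shift-invariant⇒+shift-invariant g step (+ 0) k)
+1-shift-invariant⇒constant g step -[1+ k ] =
  trans (+1-shift-invariant⇒+shift-invariant g step -[1+ k ] (suc k)) (cong g (ℤP.+-inverseˡ (+ suc k)))

module WindowSum {A : Set} {_∙_ : A → A → A} {ε : A} (isCM : IsCommutativeMonoid _≡_ _∙_ ε) where
  open IsCommutativeMonoid isCM using (assoc; comm; identityˡ; identityʳ)

  windowSum : (ℤ → A) → ℤ → ℕ → A
  windowSum h c zero    = ε
  windowSum h c (suc k) = h c ∙ windowSum h (c + + 1) k

  windowSum-cong-on : ∀ {f g} c k → (∀ t → t ℕ.< k → f (c + + t) ≡ g (c + + t)) →
                      windowSum f c k ≡ windowSum g c k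
  windowSum-cong-on c zero    eq = refl
  windowSum-cong-on {f} {g} c (suc k) eq = cong₂ _∙_ head (windowSum-cong-on (c + + 1) k tail)
    where
    head : f c ≡ g c
    head = subst (λ x → f x ≡ g x) (ℤP.+-identityʳ c) (eq 0 (ℕ.s≤s ℕ.z≤n))
    tail : ∀ t → t ℕ.< k → f (c + + 1 + + t) ≡ g (c + + 1 + + t)
    tail t t<k = subst (λ x → f x ≡ g x) (sym (ℤP.+-assoc c (+ 1) (+ t))) (eq (suc t) (ℕ.s≤s t<k))

  windowSum-cong : ∀ {f g} → f ≗ g → ∀ c k → windowSum f c k ≡ windowSum g c k
  windowSum-cong f≗g c k = windowSum-cong-on c k (λ t _ → f≗g (c + + t))

  windowSum-snoc : ∀ h c k → windowSum h c (suc k) ≡ windowSum h c k ∙ h (c + + k)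
  windowSum-snoc h c zero = begin
    h c ∙ ε         ≡⟨ identityʳ (h c) ⟩
    h c             ≡⟨ cong h (sym (ℤP.+-identityʳ c)) ⟩
    h (c + + 0)     ≡⟨ sym (identityˡ _) ⟩
    ε ∙ h (c + + 0) ∎
  windowSum-snoc h c (suc k) = begin
    h c ∙ windowSum h (c + + 1) (suc k)
      ≡⟨ cong (h c ∙_) (windowSum-snoc h (c + + 1) k) ⟩
    h c ∙ (windowSum h (c + + 1) k ∙ h (c + + 1 + + k))
      ≡⟨ sym (assoc _ _ _) ⟩
    windowSum h c (suc k) ∙ h (c + + 1 + + k)
      ≡⟨ cong (λ x → windowSum h c (suc k) ∙ h x) (ℤP.+-assoc c (+ 1) (+ k)) ⟩
    windowSum h c (suc k) ∙ h (c + + suc k) ∎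

  windowSum-rotate : ∀ h c k → h (c + + k) ≡ h c → windowSum h c k ≡ windowSum h (c + + 1) k
  windowSum-rotate h c zero    _       = refl
  windowSum-rotate h c (suc k) h-equal = begin
    h c ∙ windowSum h (c + + 1) k                ≡⟨ comm _ _ ⟩
    windowSum h (c + + 1) k ∙ h c                ≡⟨ cong (windowSum h (c + + 1) k ∙_) (sym h-equal) ⟩
    windowSum h (c + + 1) k ∙ h (c + + suc k)    ≡⟨ cong (λ x → windowSum h (c + + 1) k ∙ h x) (sym (ℤP.+-assoc c (+ 1) (+ k))) ⟩
    windowSum h (c + + 1) k ∙ h (c + + 1 + + k)  ≡⟨ sym (windowSum-snoc h (c + + 1) k) ⟩
    windowSum h (c + + 1) (suc k)                ∎

module ℕW = WindowSum ℕP.+-0-isCommutativeMonoid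
module ℤW = WindowSum ℤP.+-0-isCommutativeMonoid

windowSum-const : ∀ t c k → ℤW.windowSum (λ _ → t) c k ≡ + k * t
windowSum-const t c zero    = sym (ℤP.*-zeroˡ t)
windowSum-const t c (suc k) = begin
  t + ℤW.windowSum (λ _ → t) (c + + 1) k ≡⟨ cong (λ d → t + d) (windowSum-const t (c + + 1) k) ⟩
  t + + k * t                              ≡⟨ distrib t (+ k) ⟩
  (+ 1 + + k) * t                          ∎
  where
  distrib : ∀ t n → t + n * t ≡ (+ 1 + n) * t
  distrib = solve-∀

module AffineSymmetric (m : ℕ) where

  N : ℕ
  N = suc (suc m)

  rem : ℤ → ℕ
  rem x = x %ℕ N

  quo : ℤ → ℤ
  quo x = x /ℕ N

  rem-quo : ∀ x → x ≡ + rem x + quo x * + N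
  rem-quo x = a≡a%ℕn+[a/ℕn]*n x N

  rem<N : ∀ x → rem x ℕ.< N
  rem<N x = n%ℕd<d x N

  private
    quo-smaller-impossible : ∀ {r r′ q q′} → r ℕ.< N → + r + q * + N ≡ + r′ + q′ * + N → ¬ (q < q′)
    quo-smaller-impossible {r} {r′} {q} r<N eq q<q′ with <⇒offset q<q′
    ... | k , refl = ℕP.<-irrefl refl (ℕP.<-≤-trans r<N (ℕP.≤-trans N≤r′+N+kN (ℕP.≤-reflexive (sym r≡))))
      where
      shifted : ∀ a b q k n → a + q * n ≡ b + (q + + 1 + k) * n → a ≡ b + n + k * n
      shifted a b q k n e = begin
        a                               ≡⟨ solve (a ∷ q ∷ n ∷ []) ⟩
        (a + q * n) - q * n             ≡⟨ cong (_- q * n) e ⟩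
        (b + (q + + 1 + k) * n) - q * n ≡⟨ solve (b ∷ q ∷ k ∷ n ∷ []) ⟩
        b + n + k * n                   ∎
      r≡ : r ≡ r′ ℕ.+ N ℕ.+ k ℕ.* N
      r≡ = ℤP.+-injective (begin
        + r                        ≡⟨ shifted (+ r) (+ r′) q (+ k) (+ N) eq ⟩
        + r′ + + N + + k * + N     ≡⟨ cong (λ d → + (r′ ℕ.+ N) + d) (sym (ℤP.pos-* k N)) ⟩
        + (r′ ℕ.+ N ℕ.+ k ℕ.* N)   ∎)
      N≤r′+N+kN : N ℕ.≤ r′ ℕ.+ N ℕ.+ k ℕ.* N
      N≤r′+N+kN = ℕP.≤-trans (ℕP.m≤n+m N r′) (ℕP.m≤m+n (r′ ℕ.+ N) (k ℕ.* N))

  quo-unique : ∀ {r r′ q q′} → r ℕ.< N → r′ ℕ.< N → + r + q * + N ≡ + r′ + q′ * + N → q ≡ q′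
  quo-unique {q = q} {q′} r<N r′<N eq with ℤP.<-cmp q q′
  ... | tri< q<q′ _ _ = ⊥-elim (quo-smaller-impossible r<N eq q<q′)
  ... | tri≈ _ q≡q′ _ = q≡q′
  ... | tri> _ _ q>q′ = ⊥-elim (quo-smaller-impossible r′<N (sym eq) q>q′)

  rem-unique : ∀ {r r′ q q′} → r ℕ.< N → r′ ℕ.< N → + r + q * + N ≡ + r′ + q′ * + N → r ≡ r′
  rem-unique {r} {r′} {q} {q′} r<N r′<N eq = ℤP.+-injective (+-cancelʳ (+ r) (+ r′) (q * + N)
    (trans eq (cong (λ d → + r′ + d * + N) (sym (quo-unique {q = q} {q′} r<N r′<N eq)))))

  rem-quo-unique : ∀ x r q → x ≡ + r + q * + N → r ℕ.< N → rem x ≡ r × quo x ≡ q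
  rem-quo-unique x r q eq r<N = rem-unique {q = quo x} {q} (rem<N x) r<N e , quo-unique {q = quo x} {q} (rem<N x) r<N e
    where
    e : + rem x + quo x * + N ≡ + r + q * + N
    e = trans (sym (rem-quo x)) eq

  private
    +-multiple-decomposition : ∀ x k → x + k * + N ≡ + rem x + (quo x + k) * + N
    +-multiple-decomposition x k = trans (cong (_+ k * + N) (rem-quo x)) (regroup (+ rem x) (quo x) k (+ N))
      where
      regroup : ∀ r q k n → r + q * n + k * n ≡ r + (q + k) * n
      regroup = solve-∀

  rem-+-multiple : ∀ x k → rem (x + k * + N) ≡ rem x
  rem-+-multiple x k = proj₁ (rem-quo-unique _ (rem x) (quo x + k) (+-multiple-decomposition x k) (rem<N x))

  quo-+-multiple : ∀ x k → quo (x + k * + N) ≡ quo x + k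
  quo-+-multiple x k = proj₂ (rem-quo-unique _ (rem x) (quo x + k) (+-multiple-decomposition x k) (rem<N x))

  rem-quo-small : ∀ r → r ℕ.< N → rem (+ r) ≡ r × quo (+ r) ≡ + 0
  rem-quo-small r r<N = rem-quo-unique (+ r) r (+ 0) (sym (ℤP.+-identityʳ (+ r))) r<N

  quo-negate : ∀ x → rem x ≢ 0 → quo (- x) ≡ - quo x - + 1
  quo-negate x rem≢0 with rem x | rem<N x | rem-quo x
  ... | zero  | _     | _  = ⊥-elim (rem≢0 refl)
  ... | suc r | r<N   | eq = proj₂ (rem-quo-unique (- x) (N ℕ.∸ suc r) (- quo x - + 1) -x≡ (ℕ.s≤s (ℕP.m∸n≤m (suc m) r)))
    where
    N∸[1+r] : + (N ℕ.∸ suc r) ≡ + N - + suc r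
    N∸[1+r] = trans (sym (ℤP.≤-⊖ (ℕP.<⇒≤ r<N))) (sym (ℤP.m-n≡m⊖n N (suc r)))
    negate : ∀ x s q n → x ≡ s + q * n → - x ≡ (n - s) + (- q - + 1) * n
    negate x s q n refl = solve (s ∷ q ∷ n ∷ [])
    -x≡ : - x ≡ + (N ℕ.∸ suc r) + (- quo x - + 1) * + N
    -x≡ = trans (negate x (+ suc r) (quo x) (+ N) eq) (cong (λ d → d + (- quo x - + 1) * + N) (sym N∸[1+r]))

  quo-neg-small : ∀ r → suc r ℕ.< N → quo (- + suc r) ≡ -[1+ 0 ]
  quo-neg-small r r<N = trans (quo-negate (+ suc r) rem≢0) (cong (λ q → - q - + 1) (proj₂ (rem-quo-small (suc r) r<N)))
    where
    rem≢0 : rem (+ suc r) ≢ 0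
    rem≢0 eq = ℕP.1+n≢0 (trans (sym (proj₁ (rem-quo-small (suc r) r<N))) eq)

  quo-negative : ∀ k → Σ ℕ λ p → quo -[1+ k ] ≡ -[1+ p ]
  quo-negative k with quo -[1+ k ] | rem-quo -[1+ k ]
  ... | -[1+ p ] | _  = p , refl
  ... | + p      | eq = ⊥-elim (-[1+]≢+ (trans eq (trans (cong (λ d → + rem -[1+ k ] + d) (sym (ℤP.pos-* p N)))
                                                         (sym (ℤP.pos-+ (rem -[1+ k ]) (p ℕ.* N))))))
    where
    -[1+]≢+ : ∀ {n} → -[1+ k ] ≢ + n
    -[1+]≢+ ()

  ¬1≡multiple : ∀ q → + 1 ≢ q * + N
  ¬1≡multiple q eq = absurd (trans (sym (ℤP.abs-* q (+ N))) (cong ∣_∣ (sym eq)))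
    where
    absurd : ∣ q ∣ ℕ.* N ≢ 1
    absurd eq with ∣ q ∣
    ... | zero  = ℕP.0≢1+n eq
    ... | suc a = ℕP.1+n≢0 (ℕP.suc-injective eq)

  self-negating : ∀ q → q ≡ - q → q ≡ + 0
  self-negating q eq = ℤP.*-cancelˡ-≡ (+ 2) q (+ 0) (begin
    + 2 * q ≡⟨ solve (q ∷ []) ⟩
    q + q   ≡⟨ cong (λ d → q + d) eq ⟩
    q - q   ≡⟨ ℤP.+-inverseʳ q ⟩
    + 0     ∎)

  -- The simple transpositions s_i

  at : ℤ → ℕ → ℤ → ℤ
  at i r q = i + + r + q * + N

  at-origin : ∀ i → at i 0 (+ 0) ≡ i
  at-origin i = trans (ℤP.+-identityʳ (i + + 0)) (ℤP.+-identityʳ i)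

  at-offset-unique : ∀ i {r r′ q q′} → r ℕ.< N → r′ ℕ.< N → at i r q ≡ at i r′ q′ → r ≡ r′
  at-offset-unique i {r} {r′} {q} {q′} r<N r′<N eq = rem-unique {q = q} {q′} r<N r′<N (begin
    + r + q * + N        ≡⟨ drop-i i (+ r) q (+ N) ⟩
    at i r q - i         ≡⟨ cong (_- i) eq ⟩
    at i r′ q′ - i       ≡⟨ sym (drop-i i (+ r′) q′ (+ N)) ⟩
    + r′ + q′ * + N      ∎)
    where
    drop-i : ∀ i r q n → r + q * n ≡ i + r + q * n - i
    drop-i = solve-∀

  rem-at : ∀ i r q → r ℕ.< N → rem (at i r q - i) ≡ r
  rem-at i r q r<N = proj₁ (rem-quo-unique _ r q (drop-i i (+ r) q (+ N)) r<N)
    where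
    drop-i : ∀ i r q n → i + r + q * n - i ≡ r + q * n
    drop-i = solve-∀

  data Offset (i j : ℤ) : Set where
    offset0  : ∀ q → j ≡ at i 0 q → Offset i j
    offset1  : ∀ q → j ≡ at i 1 q → Offset i j
    offset2+ : ∀ t q → suc (suc t) ℕ.< N → j ≡ at i (suc (suc t)) q → Offset i j

  at-rem-quo : ∀ i j → j ≡ at i (rem (j - i)) (quo (j - i))
  at-rem-quo i j = begin
    j                                         ≡⟨ regroup i j ⟩
    i + (j - i)                               ≡⟨ cong (λ d → i + d) (rem-quo (j - i)) ⟩
    i + (+ rem (j - i) + quo (j - i) * + N)   ≡⟨ reassociate i (+ rem (j - i)) (quo (j - i)) (+ N) ⟩
    at i (rem (j - i)) (quo (j - i))          ∎
    where
    regroup : ∀ i j → j ≡ i + (j - i)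
    regroup = solve-∀
    reassociate : ∀ i r q n → i + (r + q * n) ≡ i + r + q * n
    reassociate = solve-∀

  offset : ∀ i j → Offset i j
  offset i j with rem (j - i) | quo (j - i) | rem<N (j - i) | at-rem-quo i j
  ... | zero        | q | _   | eq = offset0 q eq
  ... | suc zero    | q | _   | eq = offset1 q eq
  ... | suc (suc t) | q | r<N | eq = offset2+ t q r<N eq

  private
    swap-by-residue : ℕ → ℤ → ℤ
    swap-by-residue r j = if r ℕ.≡ᵇ 0 then j + + 1 else (if r ℕ.≡ᵇ 1 then j - + 1 else j)

    swap-by-residue-periodic : ∀ r j → swap-by-residue r (j + + N) ≡ swap-by-residue r j + + N
    swap-by-residue-periodic zero          j = reorder j (+ N)
      where
      reorder : ∀ j n → j + n + + 1 ≡ j + + 1 + n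
      reorder = solve-∀
    swap-by-residue-periodic (suc zero)    j = reorder j (+ N)
      where
      reorder : ∀ j n → j + n - + 1 ≡ j - + 1 + n
      reorder = solve-∀
    swap-by-residue-periodic (suc (suc r)) j = refl

    s-residue : ∀ i j {r} → rem (j - i) ≡ r → s N i j ≡ swap-by-residue r j
    s-residue i j eq = cong (λ r → swap-by-residue r j) eq

  s-at0 : ∀ i q → s N i (at i 0 q) ≡ at i 1 q
  s-at0 i q = trans (s-residue i (at i 0 q) (rem-at i 0 q (ℕ.s≤s ℕ.z≤n))) (reorder i q (+ N))
    where
    reorder : ∀ i q n → i + + 0 + q * n + + 1 ≡ i + + 1 + q * n
    reorder = solve-∀

  s-at1 : ∀ i q → s N i (at i 1 q) ≡ at i 0 q
  s-at1 i q = trans (s-residue i (at i 1 q) (rem-at i 1 q (ℕ.s≤s (ℕ.s≤s ℕ.z≤n)))) (reorder i q (+ N))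
    where
    reorder : ∀ i q n → i + + 1 + q * n - + 1 ≡ i + + 0 + q * n
    reorder = solve-∀

  s-at2+ : ∀ i t q → suc (suc t) ℕ.< N → s N i (at i (suc (suc t)) q) ≡ at i (suc (suc t)) q
  s-at2+ i t q r<N = s-residue i _ (rem-at i (suc (suc t)) q r<N)

  s-at-i : ∀ i → s N i i ≡ i + + 1
  s-at-i i = s-residue i i (cong rem (ℤP.+-inverseʳ i))

  s-at-i+1 : ∀ i → s N i (i + + 1) ≡ i
  s-at-i+1 i = trans (s-residue i (i + + 1) (cong rem (drop-i i))) (cancel i)
    where
    drop-i : ∀ i → i + + 1 - i ≡ + 1
    drop-i = solve-∀
    cancel : ∀ i → i + + 1 - + 1 ≡ i
    cancel = solve-∀

  s-fixes-window : ∀ i t → t ℕ.< m → s N i (i + + 1 + + 1 + + t) ≡ i + + 1 + + 1 + + t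
  s-fixes-window i t t<m = s-residue i _ (trans (cong rem (drop-i i (+ t))) (proj₁ (rem-quo-small (suc (suc t)) (ℕ.s≤s (ℕ.s≤s t<m)))))
    where
    drop-i : ∀ i t → i + + 1 + + 1 + t - i ≡ + 2 + t
    drop-i = solve-∀

  s-involutive : ∀ i j → s N i (s N i j) ≡ j
  s-involutive i j with offset i j
  ... | offset0 q refl      = trans (cong (s N i) (s-at0 i q)) (s-at1 i q)
  ... | offset1 q refl      = trans (cong (s N i) (s-at1 i q)) (s-at0 i q)
  ... | offset2+ t q r<N refl = trans (cong (s N i) (s-at2+ i t q r<N)) (s-at2+ i t q r<N)

  s-periodic : ∀ i j → s N i (j + + N) ≡ s N i j + + N
  s-periodic i j = trans (s-residue i (j + + N) rem≡) (swap-by-residue-periodic (rem (j - i)) j)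
    where
    reorder : ∀ j i n → j + n - i ≡ j - i + + 1 * n
    reorder = solve-∀
    rem≡ : rem (j + + N - i) ≡ rem (j - i)
    rem≡ = trans (cong rem (reorder j i (+ N))) (rem-+-multiple (j - i) (+ 1))

  s-+-multiple : ∀ i k j → s N (i + k * + N) j ≡ s N i j
  s-+-multiple i k j = s-residue (i + k * + N) j rem≡
    where
    reorder : ∀ j i k n → j - (i + k * n) ≡ j - i + (- k) * n
    reorder = solve-∀
    rem≡ : rem (j - (i + k * + N)) ≡ rem (j - i)
    rem≡ = trans (cong rem (reorder j i k (+ N))) (rem-+-multiple (j - i) (- k))

  displacement : ∀ {i x} → Offset i x → ℤ
  displacement (offset0 _ _)      = + 1
  displacement (offset1 _ _)      = - + 1
  displacement (offset2+ _ _ _ _) = + 0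

  s-displacement : ∀ i x (o : Offset i x) → s N i x ≡ x + displacement o
  s-displacement i x (offset0 q refl)        = trans (s-at0 i q) (reorder i q (+ N))
    where
    reorder : ∀ i q n → i + + 1 + q * n ≡ i + + 0 + q * n + + 1
    reorder = solve-∀
  s-displacement i x (offset1 q refl)        = trans (s-at1 i q) (reorder i q (+ N))
    where
    reorder : ∀ i q n → i + + 0 + q * n ≡ i + + 1 + q * n + - + 1
    reorder = solve-∀
  s-displacement i x (offset2+ t q r<N refl) = trans (s-at2+ i t q r<N) (sym (ℤP.+-identityʳ _))

  private
    shifted-< : ∀ x y (dx dy : ℤ) (e c j : ℕ) → y ≡ x + + 1 + (+ e + + j) →
                (∀ a J → a + + 1 + (+ e + J) + dy ≡ a + dx + + 1 + (+ c + J)) → x + dx < y + dy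
    shifted-< x y dx dy e c j refl law = offset⇒< (c ℕ.+ j) (law x (+ j))

    1<N : 1 ℕ.< N
    1<N = ℕ.s≤s (ℕ.s≤s ℕ.z≤n)

    0<N : 0 ℕ.< N
    0<N = ℕ.s≤s ℕ.z≤n

    s-monotone-offsets : ∀ i x y (ox : Offset i x) (oy : Offset i y) j → y ≡ x + + 1 + + j →
                         (∀ q → x ≡ at i 0 q → y ≢ x + + 1) → x + displacement ox < y + displacement oy
    s-monotone-offsets i x y (offset0 _ _) (offset0 _ _) j eq _ = shifted-< x y (+ 1) (+ 1) 0 0 j eq solve-∀
    s-monotone-offsets i _ _ (offset0 qx refl) (offset1 qy refl) zero eq exception =
      ⊥-elim (exception qx refl (trans eq (ℤP.+-identityʳ _)))
    s-monotone-offsets i _ _ (offset0 qx refl) (offset1 qy refl) (suc zero) eq _ =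
      ⊥-elim (¬1≡multiple (qy - qx) (difference i qx qy (+ N) eq))
      where
      difference : ∀ i qx qy n → i + + 1 + qy * n ≡ i + + 0 + qx * n + + 1 + + 1 → + 1 ≡ (qy - qx) * n
      difference i qx qy n e = begin
        + 1                                                  ≡⟨ solve (i ∷ qx ∷ n ∷ []) ⟩
        (i + + 0 + qx * n + + 1 + + 1) - (i + qx * n + + 1)  ≡⟨ cong (_- (i + qx * n + + 1)) (sym e) ⟩
        (i + + 1 + qy * n) - (i + qx * n + + 1)              ≡⟨ solve (i ∷ qx ∷ qy ∷ n ∷ []) ⟩
        (qy - qx) * n                                        ∎
    s-monotone-offsets i x y (offset0 _ _) (offset1 _ _) (suc (suc j)) eq _ = shifted-< x y (+ 1) (- + 1) 2 0 j eq solve-∀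
    s-monotone-offsets i _ _ (offset0 qx refl) (offset2+ t qy r<N refl) zero eq _ =
      ⊥-elim (ℕP.1+n≢0 (ℕP.suc-injective (at-offset-unique i {q = qy} {qx} r<N 1<N (trans eq (reorder i qx (+ N))))))
      where
      reorder : ∀ i q n → i + + 0 + q * n + + 1 + + 0 ≡ i + + 1 + q * n
      reorder = solve-∀
    s-monotone-offsets i x y (offset0 _ _) (offset2+ _ _ _ _) (suc j) eq _ = shifted-< x y (+ 1) (+ 0) 1 0 j eq solve-∀
    s-monotone-offsets i x y (offset1 _ _) (offset0 _ _) j eq _ = shifted-< x y (- + 1) (+ 1) 0 2 j eq solve-∀
    s-monotone-offsets i x y (offset1 _ _) (offset1 _ _) j eq _ = shifted-< x y (- + 1) (- + 1) 0 0 j eq solve-∀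
    s-monotone-offsets i x y (offset1 _ _) (offset2+ _ _ _ _) j eq _ = shifted-< x y (- + 1) (+ 0) 0 1 j eq solve-∀
    s-monotone-offsets i x y (offset2+ _ _ _ _) (offset0 _ _) j eq _ = shifted-< x y (+ 0) (+ 1) 0 1 j eq solve-∀
    s-monotone-offsets i _ _ (offset2+ t qx r<N refl) (offset1 qy refl) zero eq _ =
      ⊥-elim (ℕP.1+n≢0 (sym (at-offset-unique i {q = qy} {qx} 0<N r<N (predecessor i qx qy (+ _) (+ N) eq))))
      where
      predecessor : ∀ i qx qy r n → i + + 1 + qy * n ≡ i + r + qx * n + + 1 + + 0 → i + + 0 + qy * n ≡ i + r + qx * n
      predecessor i qx qy r n e = begin
        i + + 0 + qy * n                   ≡⟨ solve (i ∷ qy ∷ n ∷ []) ⟩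
        i + + 1 + qy * n - + 1             ≡⟨ cong (_- + 1) e ⟩
        i + r + qx * n + + 1 + + 0 - + 1   ≡⟨ solve (i ∷ r ∷ qx ∷ n ∷ []) ⟩
        i + r + qx * n                     ∎
    s-monotone-offsets i x y (offset2+ _ _ _ _) (offset1 _ _) (suc j) eq _ = shifted-< x y (+ 0) (- + 1) 1 0 j eq solve-∀
    s-monotone-offsets i x y (offset2+ _ _ _ _) (offset2+ _ _ _ _) j eq _ = shifted-< x y (+ 0) (+ 0) 0 0 j eq solve-∀

  s-monotone : ∀ i {x y} → x < y → (∀ q → x ≡ at i 0 q → y ≢ x + + 1) → s N i x < s N i y
  s-monotone i {x} {y} x<y exception with <⇒offset x<y
  ... | j , eq = subst₂ _<_ (sym (s-displacement i x ox)) (sym (s-displacement i y oy))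
                   (s-monotone-offsets i x y ox oy j eq exception)
    where
    ox : Offset i x
    ox = offset i x
    oy : Offset i y
    oy = offset i y

  Periodic : (ℤ → ℤ) → Set
  Periodic v = ∀ j → v (j + + N) ≡ v j + + N

  Injective : (ℤ → ℤ) → Set
  Injective v = ∀ a b → v a ≡ v b → a ≡ b

  periodic-+-multiple : ∀ {v} → Periodic v → ∀ j k → v (j + k * + N) ≡ v j + k * + N
  periodic-+-multiple {v} periodic j (+ k)    = forward j k
    where
    reorder : ∀ j k n → j + (+ 1 + k) * n ≡ j + k * n + n
    reorder = solve-∀
    forward : ∀ j k → v (j + + k * + N) ≡ v j + + k * + N
    forward j zero    = trans (cong v (ℤP.+-identityʳ j)) (sym (ℤP.+-identityʳ (v j)))
    forward j (suc k) = begin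
      v (j + + suc k * + N)       ≡⟨ cong v (reorder j (+ k) (+ N)) ⟩
      v (j + + k * + N + + N)     ≡⟨ periodic (j + + k * + N) ⟩
      v (j + + k * + N) + + N     ≡⟨ cong (_+ + N) (forward j k) ⟩
      v j + + k * + N + + N       ≡⟨ sym (reorder (v j) (+ k) (+ N)) ⟩
      v j + + suc k * + N         ∎
  periodic-+-multiple {v} periodic j -[1+ k ] = begin
    v j′                                     ≡⟨ add-sub (v j′) K (+ N) ⟩
    v j′ + K * + N - K * + N                 ≡⟨ cong (_- K * + N) (sym (periodic-+-multiple {v} periodic j′ K)) ⟩
    v (j′ + K * + N) - K * + N               ≡⟨ cong (λ x → v x - K * + N) (sub-add j K (+ N)) ⟩
    v j - K * + N                            ≡⟨ neg-mul (v j) K (+ N) ⟩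
    v j + -[1+ k ] * + N                     ∎
    where
    K : ℤ
    K = + suc k
    j′ : ℤ
    j′ = j + -[1+ k ] * + N
    add-sub : ∀ a K n → a ≡ a + K * n - K * n
    add-sub = solve-∀
    sub-add : ∀ j K n → j + (- K) * n + K * n ≡ j
    sub-add = solve-∀
    neg-mul : ∀ a K n → a - K * n ≡ a + (- K) * n
    neg-mul = solve-∀

  periodic-∘s : ∀ {v} → Periodic v → ∀ i → Periodic (λ j → v (s N i j))
  periodic-∘s {v} periodic i j = trans (cong v (s-periodic i j)) (periodic (s N i j))

  letterIndex : Fin N → ℤ
  letterIndex a = + suc (toℕ a)

  letter-decomposition : ∀ i → Σ (Fin N) λ a → Σ ℤ λ q → i ≡ letterIndex a + q * + N
  letter-decomposition i = a , quo (i - + 1) , i≡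
    where
    a : Fin N
    a = fromℕ< (rem<N (i - + 1))
    regroup : ∀ i r q n → i - + 1 ≡ r + q * n → i ≡ (+ 1 + r) + q * n
    regroup i r q n e = begin
      i                  ≡⟨ solve (i ∷ []) ⟩
      + 1 + (i - + 1)    ≡⟨ cong (λ d → + 1 + d) e ⟩
      + 1 + (r + q * n)  ≡⟨ solve (r ∷ q ∷ n ∷ []) ⟩
      (+ 1 + r) + q * n  ∎
    i≡ : i ≡ letterIndex a + quo (i - + 1) * + N
    i≡ = subst (λ r → i ≡ (+ 1 + + r) + quo (i - + 1) * + N) (sym (FinP.toℕ-fromℕ< (rem<N (i - + 1))))
           (regroup i (+ rem (i - + 1)) (quo (i - + 1)) (+ N) (rem-quo (i - + 1)))

  letter-for : ∀ i → Σ (Fin N) λ a → ∀ j → s N (letterIndex a) j ≡ s N i j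
  letter-for i with letter-decomposition i
  ... | a , q , i≡ = a , λ j → trans (sym (s-+-multiple (letterIndex a) q j)) (cong (λ c → s N c j) (sym i≡))

  -- Prepending a letter multiplies evalWord⁻¹ w by a generator on the right, which is the case the inversion count controls.
  evalWord⁻¹ : List (Fin N) → ℤ → ℤ
  evalWord⁻¹ []      j = j
  evalWord⁻¹ (a ∷ w) j = evalWord⁻¹ w (s N (letterIndex a) j)

  evalWord⁻¹-inverseʳ : ∀ w j → evalWord N w (evalWord⁻¹ w j) ≡ j
  evalWord⁻¹-inverseʳ []      j = refl
  evalWord⁻¹-inverseʳ (a ∷ w) j = trans (cong (s N (letterIndex a)) (evalWord⁻¹-inverseʳ w _)) (s-involutive (letterIndex a) j)

  evalWord-++ : ∀ u w j → evalWord N (u ++ w) j ≡ evalWord N u (evalWord N w j)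
  evalWord-++ []      w j = refl
  evalWord-++ (a ∷ u) w j = cong (s N (letterIndex a)) (evalWord-++ u w j)

  evalWord⁻¹≗evalWord-reverse : ∀ w j → evalWord⁻¹ w j ≡ evalWord N (reverse w) j
  evalWord⁻¹≗evalWord-reverse []      j = refl
  evalWord⁻¹≗evalWord-reverse (a ∷ w) j = begin
    evalWord⁻¹ w (s N (letterIndex a) j)                 ≡⟨ evalWord⁻¹≗evalWord-reverse w _ ⟩
    evalWord N (reverse w) (s N (letterIndex a) j)       ≡⟨ sym (evalWord-++ (reverse w) [ a ] j) ⟩
    evalWord N (reverse w ++ [ a ]) j                    ≡⟨ cong (λ u → evalWord N u j) (sym (ListP.unfold-reverse a w)) ⟩
    evalWord N (reverse (a ∷ w)) j                       ∎

  evalWord⁻¹-periodic : ∀ w → Periodic (evalWord⁻¹ w)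
  evalWord⁻¹-periodic []      j = refl
  evalWord⁻¹-periodic (a ∷ w) j = trans (cong (evalWord⁻¹ w) (s-periodic (letterIndex a) j)) (evalWord⁻¹-periodic w _)

  evalWord⁻¹-injective : ∀ w → Injective (evalWord⁻¹ w)
  evalWord⁻¹-injective w a b eq = trans (sym (evalWord⁻¹-inverseʳ w a)) (trans (cong (evalWord N w) eq) (evalWord⁻¹-inverseʳ w b))

  -- Shi's inversion count

  -- Every inversion class of v is counted twice, once from each end.
  pairInversions : (ℤ → ℤ) → ℤ → ℤ → ℕ
  pairInversions v a b = ∣ quo (v b - v a) - quo (b - a) ∣

  windowInversions : (ℤ → ℤ) → ℤ → ℕ
  windowInversions v c = ℕW.windowSum (λ a → ℕW.windowSum (pairInversions v a) c N) c N

  -- Opaque because unfolding the double window sum during unification is very costly.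
  opaque
    inversions : (ℤ → ℤ) → ℕ
    inversions v = windowInversions v (+ 0)

    inversions-unfold : ∀ v → inversions v ≡ windowInversions v (+ 0)
    inversions-unfold v = refl

  private
    ∣-shift-both∣ : ∀ x y k → ∣ (x + k) - (y + k) ∣ ≡ ∣ x - y ∣
    ∣-shift-both∣ x y k = cong ∣_∣ (cancel x y k)
      where
      cancel : ∀ x y k → (x + k) - (y + k) ≡ x - y
      cancel = solve-∀

  pairInversions-periodicʳ : ∀ {v} → Periodic v → ∀ a b → pairInversions v a (b + + N) ≡ pairInversions v a b
  pairInversions-periodicʳ {v} periodic a b = begin
    ∣ quo (v (b + + N) - v a) - quo (b + + N - a) ∣
      ≡⟨ cong₂ (λ x y → ∣ quo x - quo y ∣) (trans (cong (_- v a) (periodic b)) (reorder (v b) (v a) (+ N))) (reorder b a (+ N)) ⟩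
    ∣ quo (v b - v a + + 1 * + N) - quo (b - a + + 1 * + N) ∣
      ≡⟨ cong₂ (λ x y → ∣ x - y ∣) (quo-+-multiple (v b - v a) (+ 1)) (quo-+-multiple (b - a) (+ 1)) ⟩
    ∣ (quo (v b - v a) + + 1) - (quo (b - a) + + 1) ∣
      ≡⟨ ∣-shift-both∣ (quo (v b - v a)) (quo (b - a)) (+ 1) ⟩
    ∣ quo (v b - v a) - quo (b - a) ∣ ∎
    where
    reorder : ∀ x y n → x + n - y ≡ x - y + + 1 * n
    reorder = solve-∀

  pairInversions-periodicˡ : ∀ {v} → Periodic v → ∀ a b → pairInversions v (a + + N) b ≡ pairInversions v a b
  pairInversions-periodicˡ {v} periodic a b = begin
    ∣ quo (v b - v (a + + N)) - quo (b - (a + + N)) ∣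
      ≡⟨ cong₂ (λ x y → ∣ quo x - quo y ∣) (trans (cong (λ x → v b - x) (periodic a)) (reorder (v b) (v a) (+ N))) (reorder b a (+ N)) ⟩
    ∣ quo (v b - v a + - + 1 * + N) - quo (b - a + - + 1 * + N) ∣
      ≡⟨ cong₂ (λ x y → ∣ x - y ∣) (quo-+-multiple (v b - v a) (- + 1)) (quo-+-multiple (b - a) (- + 1)) ⟩
    ∣ (quo (v b - v a) + - + 1) - (quo (b - a) + - + 1) ∣
      ≡⟨ ∣-shift-both∣ (quo (v b - v a)) (quo (b - a)) (- + 1) ⟩
    ∣ quo (v b - v a) - quo (b - a) ∣ ∎
    where
    reorder : ∀ x y n → x - (y + n) ≡ x - y + - + 1 * n
    reorder = solve-∀

  pairInversions-diagonal : ∀ v a → pairInversions v a a ≡ 0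
  pairInversions-diagonal v a = cong ∣_∣ (begin
    quo (v a - v a) - quo (a - a)   ≡⟨ cong₂ (λ x y → quo x - quo y) (ℤP.+-inverseʳ (v a)) (ℤP.+-inverseʳ a) ⟩
    quo (+ 0) - quo (+ 0)           ≡⟨ ℤP.+-inverseʳ (quo (+ 0)) ⟩
    + 0                             ∎)

  windowInversions-+1 : ∀ {v} → Periodic v → ∀ c → windowInversions v c ≡ windowInversions v (c + + 1)
  windowInversions-+1 {v} periodic c = trans
    (ℕW.windowSum-rotate row c N (ℕW.windowSum-cong (pairInversions-periodicˡ {v} periodic c) c N))
    (ℕW.windowSum-cong (λ a → ℕW.windowSum-rotate (pairInversions v a) c N (pairInversions-periodicʳ {v} periodic a c)) (c + + 1) N)
    where
    row : ℤ → ℕ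
    row a = ℕW.windowSum (pairInversions v a) c N

  windowInversions≡inversions : ∀ {v} → Periodic v → ∀ c → windowInversions v c ≡ inversions v
  windowInversions≡inversions {v} periodic c =
    trans (+1-shift-invariant⇒constant (windowInversions v) (windowInversions-+1 {v} periodic) c) (sym (inversions-unfold v))

  inversions-cong : ∀ {v w} → (∀ j → v j ≡ w j) → inversions v ≡ inversions w
  inversions-cong {v} {w} v≗w = trans (inversions-unfold v) (trans (ℕW.windowSum-cong (λ a → ℕW.windowSum-cong (λ b →
    cong₂ (λ x y → ∣ quo (x - y) - quo (b - a) ∣) (v≗w b) (v≗w a)) (+ 0) N) (+ 0) N) (sym (inversions-unfold w)))

  inversions-id : inversions (λ j → j) ≡ 0
  inversions-id = trans (inversions-unfold (λ j → j)) (trans (ℕW.windowSum-cong (λ a →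
    trans (ℕW.windowSum-cong (pairInversions-diagonal′ a) (+ 0) N) (zeros (+ 0) N)) (+ 0) N) (zeros (+ 0) N))
    where
    pairInversions-diagonal′ : ∀ a b → pairInversions (λ j → j) a b ≡ 0
    pairInversions-diagonal′ a b = cong ∣_∣ (ℤP.+-inverseʳ (quo (b - a)))
    zeros : ∀ c k → ℕW.windowSum (λ _ → 0) c k ≡ 0
    zeros c zero    = refl
    zeros c (suc k) = zeros (c + + 1) k

  module _ (v : ℤ → ℤ) (i : ℤ) where
    private
      g : ℤ → ℤ
      g j = v (s N i j)

      i₁ : ℤ
      i₁ = i + + 1

      P : ℤ
      P = quo (v i₁ - v i)

      restSum : (ℤ → ℕ) → ℕ
      restSum h = ℕW.windowSum h (i₁ + + 1) m

      row : (ℤ → ℤ) → ℤ → ℕ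
      row w a = ℕW.windowSum (pairInversions w a) i N

      rest : ℕ → ℤ
      rest t = i₁ + + 1 + + t

      pairInversions-∘s : ∀ a b {a′ b′} → s N i a ≡ a′ → s N i b ≡ b′ → quo (b - a) ≡ quo (b′ - a′) →
                          pairInversions g a b ≡ pairInversions v a′ b′
      pairInversions-∘s a b refl refl q≡ = cong (λ q → ∣ quo (v (s N i b) - v (s N i a)) - q ∣) q≡

      quo-rest-i : ∀ t → t ℕ.< m → quo (rest t - i) ≡ quo (rest t - i₁)
      quo-rest-i t t<m = begin
        quo (rest t - i)     ≡⟨ cong quo (drop-i i (+ t)) ⟩
        quo (+ suc (suc t))  ≡⟨ proj₂ (rem-quo-small (suc (suc t)) (ℕ.s≤s (ℕ.s≤s t<m))) ⟩
        + 0                  ≡⟨ sym (proj₂ (rem-quo-small (suc t) (ℕ.s≤s (ℕ.s≤s (ℕP.<⇒≤ t<m))))) ⟩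
        quo (+ suc t)        ≡⟨ cong quo (sym (drop-i₁ i (+ t))) ⟩
        quo (rest t - i₁)    ∎
        where
        drop-i : ∀ i t → i + + 1 + + 1 + t - i ≡ + 2 + t
        drop-i = solve-∀
        drop-i₁ : ∀ i t → i + + 1 + + 1 + t - (i + + 1) ≡ + 1 + t
        drop-i₁ = solve-∀

      quo-i-rest : ∀ t → t ℕ.< m → quo (i - rest t) ≡ quo (i₁ - rest t)
      quo-i-rest t t<m = begin
        quo (i - rest t)       ≡⟨ cong quo (drop-i i (+ t)) ⟩
        quo (- + suc (suc t))  ≡⟨ quo-neg-small (suc t) (ℕ.s≤s (ℕ.s≤s t<m)) ⟩
        -[1+ 0 ]               ≡⟨ sym (quo-neg-small t (ℕ.s≤s (ℕ.s≤s (ℕP.<⇒≤ t<m)))) ⟩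
        quo (- + suc t)        ≡⟨ cong quo (sym (drop-i₁ i (+ t))) ⟩
        quo (i₁ - rest t)      ∎
        where
        drop-i : ∀ i t → i - (i + + 1 + + 1 + t) ≡ - (+ 2 + t)
        drop-i = solve-∀
        drop-i₁ : ∀ i t → i + + 1 - (i + + 1 + + 1 + t) ≡ - (+ 1 + t)
        drop-i₁ = solve-∀

      restSum-i : restSum (pairInversions g i) ≡ restSum (pairInversions v i₁)
      restSum-i = ℕW.windowSum-cong-on _ m (λ t t<m → pairInversions-∘s i (rest t) (s-at-i i) (s-fixes-window i t t<m) (quo-rest-i t t<m))

      restSum-i₁ : restSum (pairInversions g i₁) ≡ restSum (pairInversions v i)
      restSum-i₁ = ℕW.windowSum-cong-on _ m (λ t t<m → pairInversions-∘s i₁ (rest t) (s-at-i+1 i) (s-fixes-window i t t<m) (sym (quo-rest-i t t<m)))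

      row-rest : ∀ t → t ℕ.< m → row g (rest t) ≡ row v (rest t)
      row-rest t t<m = begin
        pairInversions g x i ℕ.+ (pairInversions g x i₁ ℕ.+ restSum (pairInversions g x))
          ≡⟨ cong₂ (λ a b → a ℕ.+ (b ℕ.+ restSum (pairInversions g x)))
               (pairInversions-∘s x i x-fixed (s-at-i i) (quo-i-rest t t<m))
               (pairInversions-∘s x i₁ x-fixed (s-at-i+1 i) (sym (quo-i-rest t t<m))) ⟩
        pairInversions v x i₁ ℕ.+ (pairInversions v x i ℕ.+ restSum (pairInversions g x))
          ≡⟨ cong (λ c → pairInversions v x i₁ ℕ.+ (pairInversions v x i ℕ.+ c))
               (ℕW.windowSum-cong-on _ m (λ u u<m → pairInversions-∘s x (rest u) x-fixed (s-fixes-window i u u<m) refl)) ⟩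
        pairInversions v x i₁ ℕ.+ (pairInversions v x i ℕ.+ restSum (pairInversions v x))
          ≡⟨ x∙yz≈y∙xz (pairInversions v x i₁) (pairInversions v x i) _ ⟩
        pairInversions v x i ℕ.+ (pairInversions v x i₁ ℕ.+ restSum (pairInversions v x)) ∎
        where
        x : ℤ
        x = rest t
        x-fixed : s N i x ≡ x
        x-fixed = s-fixes-window i t t<m

      restSum-row : restSum (row g) ≡ restSum (row v)
      restSum-row = ℕW.windowSum-cong-on _ m row-rest

      split : ∀ w → windowInversions w i ≡
              (pairInversions w i i₁ ℕ.+ restSum (pairInversions w i)) ℕ.+ (pairInversions w i₁ i ℕ.+ restSum (pairInversions w i₁))
              ℕ.+ restSum (row w)
      split w = arrange (pairInversions w i i) (pairInversions w i i₁) (restSum (pairInversions w i))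
                        (pairInversions w i₁ i) (pairInversions w i₁ i₁) (restSum (pairInversions w i₁)) (restSum (row w))
                        (pairInversions-diagonal w i) (pairInversions-diagonal w i₁)
        where
        arrange : ∀ a b c d e f z → a ≡ 0 → e ≡ 0 →
                  (a ℕ.+ (b ℕ.+ c)) ℕ.+ ((d ℕ.+ (e ℕ.+ f)) ℕ.+ z) ≡ (b ℕ.+ c) ℕ.+ (d ℕ.+ f) ℕ.+ z
        arrange _ b c d _ f z refl refl = sym (ℕP.+-assoc (b ℕ.+ c) (d ℕ.+ f) z)

      quo-i₁-i : quo (i₁ - i) ≡ + 0
      quo-i₁-i = cong quo (drop-i i)
        where
        drop-i : ∀ i → i + + 1 - i ≡ + 1
        drop-i = solve-∀

      quo-i-i₁ : quo (i - i₁) ≡ -[1+ 0 ]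
      quo-i-i₁ = trans (cong quo (drop-i i)) (quo-neg-small 0 (ℕ.s≤s (ℕ.s≤s ℕ.z≤n)))
        where
        drop-i : ∀ i → i - (i + + 1) ≡ - + 1
        drop-i = solve-∀

      quo-reversed : rem (v i₁ - v i) ≢ 0 → quo (v i - v i₁) ≡ - P - + 1
      quo-reversed rem≢0 = trans (cong quo (negate (v i) (v i₁))) (quo-negate (v i₁ - v i) rem≢0)
        where
        negate : ∀ a b → a - b ≡ - (b - a)
        negate = solve-∀

      v-i-i₁ : pairInversions v i i₁ ≡ ∣ P ∣
      v-i-i₁ = begin
        ∣ P - quo (i₁ - i) ∣   ≡⟨ cong (λ q → ∣ P - q ∣) quo-i₁-i ⟩
        ∣ P - + 0 ∣            ≡⟨ cong ∣_∣ (ℤP.+-identityʳ P) ⟩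
        ∣ P ∣                  ∎

      v-i₁-i : rem (v i₁ - v i) ≢ 0 → pairInversions v i₁ i ≡ ∣ P ∣
      v-i₁-i rem≢0 = begin
        ∣ quo (v i - v i₁) - quo (i - i₁) ∣  ≡⟨ cong₂ (λ a b → ∣ a - b ∣) (quo-reversed rem≢0) quo-i-i₁ ⟩
        ∣ (- P - + 1) - - + 1 ∣              ≡⟨ cong ∣_∣ (simplify P) ⟩
        ∣ - P ∣                              ≡⟨ ℤP.∣-i∣≡∣i∣ P ⟩
        ∣ P ∣                                ∎
        where
        simplify : ∀ p → (- p - + 1) - - + 1 ≡ - p
        simplify = solve-∀

      g-i-i₁ : rem (v i₁ - v i) ≢ 0 → pairInversions g i i₁ ≡ ∣ P + + 1 ∣
      g-i-i₁ rem≢0 = begin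
        ∣ quo (v (s N i i₁) - v (s N i i)) - quo (i₁ - i) ∣  ≡⟨ cong₂ (λ a b → ∣ quo (v a - v b) - quo (i₁ - i) ∣) (s-at-i+1 i) (s-at-i i) ⟩
        ∣ quo (v i - v i₁) - quo (i₁ - i) ∣                  ≡⟨ cong₂ (λ a b → ∣ a - b ∣) (quo-reversed rem≢0) quo-i₁-i ⟩
        ∣ (- P - + 1) - + 0 ∣                                ≡⟨ cong ∣_∣ (simplify P) ⟩
        ∣ - (P + + 1) ∣                                      ≡⟨ ℤP.∣-i∣≡∣i∣ (P + + 1) ⟩
        ∣ P + + 1 ∣                                          ∎
        where
        simplify : ∀ p → (- p - + 1) - + 0 ≡ - (p + + 1)
        simplify = solve-∀

      g-i₁-i : pairInversions g i₁ i ≡ ∣ P + + 1 ∣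
      g-i₁-i = begin
        ∣ quo (v (s N i i) - v (s N i i₁)) - quo (i - i₁) ∣  ≡⟨ cong₂ (λ a b → ∣ quo (v a - v b) - quo (i - i₁) ∣) (s-at-i i) (s-at-i+1 i) ⟩
        ∣ P - quo (i - i₁) ∣                                 ≡⟨ cong (λ q → ∣ P - q ∣) quo-i-i₁ ⟩
        ∣ P - - + 1 ∣                                        ≡⟨ cong ∣_∣ (simplify P) ⟩
        ∣ P + + 1 ∣                                          ∎
        where
        simplify : ∀ p → p - - + 1 ≡ p + + 1
        simplify = solve-∀

    windowInversions-∘s : rem (v (i + + 1) - v i) ≢ 0 →
                          let p = quo (v (i + + 1) - v i) in
                          windowInversions (λ j → v (s N i j)) i ℕ.+ (∣ p ∣ ℕ.+ ∣ p ∣)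
                          ≡ windowInversions v i ℕ.+ (∣ p + + 1 ∣ ℕ.+ ∣ p + + 1 ∣)
    windowInversions-∘s rem≢0 = begin
      windowInversions g i ℕ.+ (∣ P ∣ ℕ.+ ∣ P ∣)
        ≡⟨ cong (λ n → n ℕ.+ (∣ P ∣ ℕ.+ ∣ P ∣)) (trans (split g) (cong₂ ℕ._+_ (cong₂ ℕ._+_
             (cong₂ ℕ._+_ (g-i-i₁ rem≢0) restSum-i) (cong₂ ℕ._+_ g-i₁-i restSum-i₁)) restSum-row)) ⟩
      ((∣ P + + 1 ∣ ℕ.+ Y) ℕ.+ (∣ P + + 1 ∣ ℕ.+ X) ℕ.+ Z) ℕ.+ (∣ P ∣ ℕ.+ ∣ P ∣)
        ≡⟨ rearrange ∣ P ∣ ∣ P + + 1 ∣ X Y Z ⟩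
      ((∣ P ∣ ℕ.+ X) ℕ.+ (∣ P ∣ ℕ.+ Y) ℕ.+ Z) ℕ.+ (∣ P + + 1 ∣ ℕ.+ ∣ P + + 1 ∣)
        ≡⟨ cong (λ n → n ℕ.+ (∣ P + + 1 ∣ ℕ.+ ∣ P + + 1 ∣)) (sym (trans (split v) (cong₂ ℕ._+_ (cong₂ ℕ._+_
             (cong (λ n → n ℕ.+ X) v-i-i₁) (cong (λ n → n ℕ.+ Y) (v-i₁-i rem≢0))) refl))) ⟩
      windowInversions v i ℕ.+ (∣ P + + 1 ∣ ℕ.+ ∣ P + + 1 ∣) ∎
      where
      X : ℕ
      X = restSum (pairInversions v i)
      Y : ℕ
      Y = restSum (pairInversions v i₁)
      Z : ℕ
      Z = restSum (row v)
      rearrange : ∀ p p₁ x y z → ((p₁ ℕ.+ y) ℕ.+ (p₁ ℕ.+ x) ℕ.+ z) ℕ.+ (p ℕ.+ p) ≡ ((p ℕ.+ x) ℕ.+ (p ℕ.+ y) ℕ.+ z) ℕ.+ (p₁ ℕ.+ p₁)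
      rearrange = ℕSolver.solve-∀

  rem-difference≢0 : ∀ {v} → Periodic v → Injective v → ∀ i → rem (v (i + + 1) - v i) ≢ 0
  rem-difference≢0 {v} periodic injective i rem≡0 = ¬1≡multiple q (begin
    + 1                ≡⟨ solve (i ∷ []) ⟩
    (i + + 1) - i      ≡⟨ cong (_- i) i+1≡ ⟩
    (i + q * + N) - i  ≡⟨ drop-i i (q * + N) ⟩
    q * + N            ∎)
    where
    q : ℤ
    q = quo (v (i + + 1) - v i)
    drop-i : ∀ i d → (i + d) - i ≡ d
    drop-i = solve-∀
    add-difference : ∀ a b → b ≡ a + (b - a)
    add-difference = solve-∀
    difference : v (i + + 1) - v i ≡ q * + N
    difference = trans (rem-quo _) (trans (cong (λ r → + r + q * + N) rem≡0) (ℤP.+-identityˡ _))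
    i+1≡ : i + + 1 ≡ i + q * + N
    i+1≡ = injective _ _ (begin
      v (i + + 1)                 ≡⟨ add-difference (v i) (v (i + + 1)) ⟩
      v i + (v (i + + 1) - v i)   ≡⟨ cong (λ d → v i + d) difference ⟩
      v i + q * + N               ≡⟨ sym (periodic-+-multiple {v} periodic i q) ⟩
      v (i + q * + N)             ∎)

  private
    ∣+1∣-nonneg : ∀ p → ∣ + p + + 1 ∣ ≡ suc p
    ∣+1∣-nonneg p = ℕP.+-comm p 1

    ∣+1∣-neg : ∀ p → ∣ -[1+ p ] ∣ ≡ suc ∣ -[1+ p ] + + 1 ∣
    ∣+1∣-neg p = cong suc (sym (trans (cong ∣_∣ (simplify (+ p))) (ℤP.∣-i∣≡∣i∣ (+ p))))
      where
      simplify : ∀ p → - (+ 1 + p) + + 1 ≡ - p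
      simplify = solve-∀

    shift-by-two : ∀ x y a → x ℕ.+ (a ℕ.+ a) ≡ y ℕ.+ (suc a ℕ.+ suc a) → x ≡ 2 ℕ.+ y
    shift-by-two x y a eq = ℕP.+-cancelʳ-≡ (a ℕ.+ a) x (2 ℕ.+ y) (trans eq (regroup y a))
      where
      regroup : ∀ y a → y ℕ.+ ((1 ℕ.+ a) ℕ.+ (1 ℕ.+ a)) ≡ (2 ℕ.+ y) ℕ.+ (a ℕ.+ a)
      regroup = ℕSolver.solve-∀

  inversions-∘s-ascent : ∀ {v} → Periodic v → Injective v → ∀ i → v i < v (i + + 1) →
                         inversions (λ j → v (s N i j)) ≡ 2 ℕ.+ inversions v
  inversions-∘s-ascent {v} periodic injective i ascent with <⇒offset ascent
  ... | k , eq = shift-by-two _ _ ∣ P ∣ (begin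
    inversions g ℕ.+ (∣ P ∣ ℕ.+ ∣ P ∣)
      ≡⟨ cong (λ n → n ℕ.+ (∣ P ∣ ℕ.+ ∣ P ∣)) (sym (windowInversions≡inversions {g} (periodic-∘s {v} periodic i) i)) ⟩
    windowInversions g i ℕ.+ (∣ P ∣ ℕ.+ ∣ P ∣)
      ≡⟨ windowInversions-∘s v i (rem-difference≢0 {v} periodic injective i) ⟩
    windowInversions v i ℕ.+ (∣ P + + 1 ∣ ℕ.+ ∣ P + + 1 ∣)
      ≡⟨ cong₂ (λ n a → n ℕ.+ (a ℕ.+ a)) (windowInversions≡inversions {v} periodic i) ∣P+1∣ ⟩
    inversions v ℕ.+ (suc ∣ P ∣ ℕ.+ suc ∣ P ∣) ∎)
    where
    g : ℤ → ℤ
    g = λ j → v (s N i j)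
    P : ℤ
    P = quo (v (i + + 1) - v i)
    drop : ∀ a k → a + + 1 + k - a ≡ + 1 + k
    drop = solve-∀
    difference : v (i + + 1) - v i ≡ + suc k
    difference = trans (cong (_- v i) eq) (drop (v i) (+ k))
    ∣P+1∣ : ∣ P + + 1 ∣ ≡ suc ∣ P ∣
    ∣P+1∣ = subst (λ p → ∣ p + + 1 ∣ ≡ suc ∣ p ∣) (cong quo (sym difference)) (∣+1∣-nonneg _)

  inversions-∘s-descent : ∀ {v} → Periodic v → Injective v → ∀ i → v (i + + 1) < v i →
                          2 ℕ.+ inversions (λ j → v (s N i j)) ≡ inversions v
  inversions-∘s-descent {v} periodic injective i descent with <⇒offset descent
  ... | k , eq with quo-negative k
  ... | p , P≡ = sym (shift-by-two _ _ ∣ P + + 1 ∣ (begin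
    inversions v ℕ.+ (∣ P + + 1 ∣ ℕ.+ ∣ P + + 1 ∣)
      ≡⟨ cong (λ n → n ℕ.+ (∣ P + + 1 ∣ ℕ.+ ∣ P + + 1 ∣)) (sym (windowInversions≡inversions {v} periodic i)) ⟩
    windowInversions v i ℕ.+ (∣ P + + 1 ∣ ℕ.+ ∣ P + + 1 ∣)
      ≡⟨ sym (windowInversions-∘s v i (rem-difference≢0 {v} periodic injective i)) ⟩
    windowInversions g i ℕ.+ (∣ P ∣ ℕ.+ ∣ P ∣)
      ≡⟨ cong₂ (λ n a → n ℕ.+ (a ℕ.+ a)) (windowInversions≡inversions {g} (periodic-∘s {v} periodic i) i) ∣P∣ ⟩
    inversions g ℕ.+ (suc ∣ P + + 1 ∣ ℕ.+ suc ∣ P + + 1 ∣) ∎))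
    where
    g : ℤ → ℤ
    g = λ j → v (s N i j)
    P : ℤ
    P = quo (v (i + + 1) - v i)
    drop : ∀ b k → b - (b + + 1 + k) ≡ - (+ 1 + k)
    drop = solve-∀
    difference : v (i + + 1) - v i ≡ -[1+ k ]
    difference = trans (cong (λ a → v (i + + 1) - a) eq) (drop (v (i + + 1)) (+ k))
    ∣P∣ : ∣ P ∣ ≡ suc ∣ P + + 1 ∣
    ∣P∣ = subst (λ q → ∣ q ∣ ≡ suc ∣ q + + 1 ∣) (sym (trans (cong quo difference) P≡)) (∣+1∣-neg p)

  -- Coxeter length

  private
    i≢i+1 : ∀ i → i ≢ i + + 1
    i≢i+1 i e = ℤP.<-irrefl e (offset⇒< 0 (sym (ℤP.+-identityʳ (i + + 1))))

  ascending-everywhere : ∀ {v} → Periodic v → Injective v → (∀ a → ¬ (v (letterIndex a + + 1) < v (letterIndex a))) →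
                         ∀ i → v i < v (i + + 1)
  ascending-everywhere {v} periodic injective no-descent i with letter-decomposition i
  ... | a , q , refl = subst₂ _<_ (sym (periodic-+-multiple {v} periodic ι q)) shifted
                         (ℤP.+-monoˡ-< (q * + N) ascent)
    where
    ι : ℤ
    ι = letterIndex a
    ascent : v ι < v (ι + + 1)
    ascent = ℤP.≤∧≢⇒< (ℤP.≮⇒≥ (no-descent a)) (λ e → i≢i+1 ι (injective _ _ e))
    reorder : ∀ a q n → a + q * n + + 1 ≡ a + + 1 + q * n
    reorder = solve-∀
    shifted : v (ι + + 1) + q * + N ≡ v (ι + q * + N + + 1)
    shifted = trans (sym (periodic-+-multiple {v} periodic (ι + + 1) q)) (cong v (sym (reorder ι q (+ N))))

  unit-steps : ∀ {v} → Periodic v → (∀ i → v i < v (i + + 1)) → ∀ i → v (i + + 1) ≡ v i + + 1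
  unit-steps {v} periodic ascending i = ℤP.≤-antisym upper lower
    where
    grow : ∀ j k → v j + + k ≤ v (j + + k)
    grow j zero    = ℤP.≤-reflexive (trans (ℤP.+-identityʳ (v j)) (cong v (sym (ℤP.+-identityʳ j))))
    grow j (suc k) with ≤⇒offset (grow j k) | <⇒offset (ascending (j + + k))
    ... | a , ea | b , eb = offset⇒≤ (a ℕ.+ b) (begin
      v (j + + suc k)                 ≡⟨ cong v (sym (+-suc j k)) ⟩
      v (j + + k + + 1)               ≡⟨ eb ⟩
      v (j + + k) + + 1 + + b         ≡⟨ cong (λ x → x + + 1 + + b) ea ⟩
      v j + + k + + a + + 1 + + b     ≡⟨ regroup (v j) (+ k) (+ a) (+ b) ⟩
      v j + + suc k + + (a ℕ.+ b)     ∎)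
      where
      regroup : ∀ x k a b → x + k + a + + 1 + b ≡ x + (+ 1 + k) + (a + b)
      regroup = solve-∀
    upper : v (i + + 1) ≤ v i + + 1
    upper with ≤⇒offset (grow (i + + 1) (suc m))
    ... | c , ec = offset⇒≤ c (+-cancelʳ _ _ (+ suc m) (begin
      v i + + 1 + + suc m                 ≡⟨ regroup₁ (v i) (+ suc m) ⟩
      v i + + N                           ≡⟨ sym (periodic i) ⟩
      v (i + + N)                         ≡⟨ cong v (regroup₂ i (+ suc m)) ⟩
      v (i + + 1 + + suc m)               ≡⟨ ec ⟩
      v (i + + 1) + + suc m + + c         ≡⟨ regroup₃ (v (i + + 1)) (+ suc m) (+ c) ⟩
      v (i + + 1) + + c + + suc m         ∎))
      where
      regroup₁ : ∀ a x → a + + 1 + x ≡ a + (+ 1 + x)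
      regroup₁ = solve-∀
      regroup₂ : ∀ i x → i + (+ 1 + x) ≡ i + + 1 + x
      regroup₂ = solve-∀
      regroup₃ : ∀ a x c → a + x + c ≡ a + c + x
      regroup₃ = solve-∀
    lower : v i + + 1 ≤ v (i + + 1)
    lower = subst (_≤ v (i + + 1)) (ℤP.+-comm (+ 1) (v i)) (ℤP.i<j⇒suc[i]≤j (ascending i))

  displacementSum : (ℤ → ℤ) → ℤ → ℤ
  displacementSum v c = ℤW.windowSum (λ j → v j - j) c N

  displacementSum-+1 : ∀ {v} → Periodic v → ∀ c → displacementSum v c ≡ displacementSum v (c + + 1)
  displacementSum-+1 {v} periodic c = ℤW.windowSum-rotate (λ j → v j - j) c N
    (trans (cong (_- (c + + N)) (periodic c)) (cancel (v c) c (+ N)))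
    where
    cancel : ∀ a c n → a + n - (c + n) ≡ a - c
    cancel = solve-∀

  displacementSum-∘s : ∀ v i → displacementSum (λ j → v (s N i j)) i ≡ displacementSum v i
  displacementSum-∘s v i = begin
    (v (s N i i) - i) + ((v (s N i i₁) - i₁) + ℤW.windowSum (λ j → v (s N i j) - j) (i₁ + + 1) m)
      ≡⟨ cong₂ (λ a b → (v a - i) + ((v b - i₁) + ℤW.windowSum (λ j → v (s N i j) - j) (i₁ + + 1) m)) (s-at-i i) (s-at-i+1 i) ⟩
    (v i₁ - i) + ((v i - i₁) + ℤW.windowSum (λ j → v (s N i j) - j) (i₁ + + 1) m)
      ≡⟨ cong (λ S → (v i₁ - i) + ((v i - i₁) + S)) (ℤW.windowSum-cong-on _ m (λ t t<m → cong (λ x → v x - _) (s-fixes-window i t t<m))) ⟩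
    (v i₁ - i) + ((v i - i₁) + ℤW.windowSum (λ j → v j - j) (i₁ + + 1) m)
      ≡⟨ exchange (v i) (v i₁) i i₁ _ ⟩
    (v i - i) + ((v i₁ - i₁) + ℤW.windowSum (λ j → v j - j) (i₁ + + 1) m) ∎
    where
    i₁ : ℤ
    i₁ = i + + 1
    exchange : ∀ a b i i₁ S → (b - i) + ((a - i₁) + S) ≡ (a - i) + ((b - i₁) + S)
    exchange = solve-∀

  displacementSum-evalWord⁻¹ : ∀ u c → displacementSum (evalWord⁻¹ u) c ≡ + 0
  displacementSum-evalWord⁻¹ []      c =
    trans (ℤW.windowSum-cong ℤP.+-inverseʳ c N) (trans (windowSum-const (+ 0) c N) (ℤP.*-zeroʳ (+ N)))
  displacementSum-evalWord⁻¹ (a ∷ u) c = begin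
    displacementSum v c      ≡⟨ constant c ⟩
    displacementSum v (+ 0)  ≡⟨ sym (constant (letterIndex a)) ⟩
    displacementSum v (letterIndex a)                ≡⟨ displacementSum-∘s (evalWord⁻¹ u) (letterIndex a) ⟩
    displacementSum (evalWord⁻¹ u) (letterIndex a)   ≡⟨ displacementSum-evalWord⁻¹ u (letterIndex a) ⟩
    + 0                      ∎
    where
    v : ℤ → ℤ
    v = evalWord⁻¹ (a ∷ u)
    constant : ∀ c → displacementSum v c ≡ displacementSum v (+ 0)
    constant = +1-shift-invariant⇒constant (displacementSum v) (displacementSum-+1 {v} (evalWord⁻¹-periodic (a ∷ u)))

  -- Without descents v is a translation j ↦ j + t, and the vanishing displacement sum forces t = 0.
  no-descent⇒identity : ∀ u → (∀ a → ¬ (evalWord⁻¹ u (letterIndex a + + 1) < evalWord⁻¹ u (letterIndex a))) →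
                        ∀ j → evalWord⁻¹ u j ≡ j
  no-descent⇒identity u no-descent j = begin
    v j              ≡⟨ split (v j) j ⟩
    (v j - j) + j    ≡⟨ cong (_+ j) (trans (translation j) t≡0) ⟩
    + 0 + j          ≡⟨ ℤP.+-identityˡ j ⟩
    j                ∎
    where
    v : ℤ → ℤ
    v = evalWord⁻¹ u
    split : ∀ a j → a ≡ (a - j) + j
    split = solve-∀
    shift : ∀ a c → a - c ≡ a + + 1 - (c + + 1)
    shift = solve-∀
    steps : ∀ i → v (i + + 1) ≡ v i + + 1
    steps = unit-steps {v} (evalWord⁻¹-periodic u)
              (ascending-everywhere {v} (evalWord⁻¹-periodic u) (evalWord⁻¹-injective u) no-descent)
    translation : ∀ j → v j - j ≡ v (+ 0) - + 0
    translation = +1-shift-invariant⇒constant (λ j → v j - j)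
                    (λ c → trans (shift (v c) c) (cong (_- (c + + 1)) (sym (steps c))))
    t : ℤ
    t = v (+ 0) - + 0
    t≡0 : t ≡ + 0
    t≡0 = ℤP.*-cancelˡ-≡ (+ N) t (+ 0) (begin
      + N * t                          ≡⟨ sym (windowSum-const t (+ 0) N) ⟩
      ℤW.windowSum (λ _ → t) (+ 0) N   ≡⟨ sym (ℤW.windowSum-cong translation (+ 0) N) ⟩
      displacementSum v (+ 0)          ≡⟨ displacementSum-evalWord⁻¹ u (+ 0) ⟩
      + 0                              ≡⟨ sym (ℤP.*-zeroʳ (+ N)) ⟩
      + N * + 0                        ∎)

  inversions-evalWord⁻¹-≤ : ∀ u → inversions (evalWord⁻¹ u) ℕ.≤ length u ℕ.+ length u
  inversions-evalWord⁻¹-≤ []      = ℕP.≤-reflexive inversions-id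
  inversions-evalWord⁻¹-≤ (a ∷ u) with ℤP.<-cmp (evalWord⁻¹ u (letterIndex a)) (evalWord⁻¹ u (letterIndex a + + 1))
  ... | tri< ascent _ _ = ℕP.≤-trans
    (ℕP.≤-reflexive (inversions-∘s-ascent {evalWord⁻¹ u} (evalWord⁻¹-periodic u) (evalWord⁻¹-injective u) _ ascent))
    (ℕP.≤-trans (ℕP.+-monoʳ-≤ 2 (inversions-evalWord⁻¹-≤ u)) (ℕP.≤-reflexive (cong suc (sym (ℕP.+-suc (length u) (length u))))))
  ... | tri≈ _ equal _ = ⊥-elim (i≢i+1 (letterIndex a) (evalWord⁻¹-injective u _ _ equal))
  ... | tri> _ _ descent = ℕP.≤-trans (ℕP.m≤n+m _ 2) (ℕP.≤-trans
    (ℕP.≤-reflexive (inversions-∘s-descent {evalWord⁻¹ u} (evalWord⁻¹-periodic u) (evalWord⁻¹-injective u) _ descent))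
    (ℕP.≤-trans (inversions-evalWord⁻¹-≤ u) (ℕP.+-mono-≤ (ℕP.n≤1+n _) (ℕP.n≤1+n _))))

  HasDescent : List (Fin N) → Set
  HasDescent u = Σ (Fin N) λ a → evalWord⁻¹ u (letterIndex a + + 1) < evalWord⁻¹ u (letterIndex a)

  ShortWordFor : List (Fin N) → Set
  ShortWordFor u = Σ (List (Fin N)) λ u′ → (∀ j → evalWord⁻¹ u′ j ≡ evalWord⁻¹ u j)
                                         × inversions (evalWord⁻¹ u) ≡ length u′ ℕ.+ length u′

  private
    descent? : ∀ u → Dec (HasDescent u)
    descent? u = FinP.any? (λ a → evalWord⁻¹ u (letterIndex a + + 1) ℤ.<? evalWord⁻¹ u (letterIndex a))

    drop-letter : ∀ u a → evalWord⁻¹ u (letterIndex a + + 1) < evalWord⁻¹ u (letterIndex a) →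
                  2 ℕ.+ inversions (evalWord⁻¹ (a ∷ u)) ≡ inversions (evalWord⁻¹ u)
    drop-letter u a = inversions-∘s-descent {evalWord⁻¹ u} (evalWord⁻¹-periodic u) (evalWord⁻¹-injective u) _

    empty-word : ∀ u → ¬ HasDescent u → ShortWordFor u
    empty-word u no-descent = [] , (λ j → sym (identity j)) , trans (inversions-cong identity) inversions-id
      where
      identity : ∀ j → evalWord⁻¹ u j ≡ j
      identity = no-descent⇒identity u (λ a d → no-descent (a , d))

    prepend-letter : ∀ u a → 2 ℕ.+ inversions (evalWord⁻¹ (a ∷ u)) ≡ inversions (evalWord⁻¹ u) → ShortWordFor (a ∷ u) → ShortWordFor u
    prepend-letter u a dropped (u′ , u′≗ , inversions≡) =
      a ∷ u′ ,
      (λ j → trans (u′≗ (s N (letterIndex a) j)) (cong (evalWord⁻¹ u) (s-involutive (letterIndex a) j))) ,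
      trans (sym dropped) (trans (cong (2 ℕ.+_) inversions≡) (cong suc (sym (ℕP.+-suc (length u′) (length u′)))))

    drop-two : ∀ {x b} → 2 ℕ.+ x ℕ.≤ suc b → x ℕ.≤ b
    drop-two (ℕ.s≤s le) = ℕP.≤-trans (ℕP.n≤1+n _) le

    shortest-word-below : ∀ b u → inversions (evalWord⁻¹ u) ℕ.≤ b → ShortWordFor u
    shortest-word-below b u bound with descent? u
    shortest-word-below _       u bound | no no-descent = empty-word u no-descent
    shortest-word-below zero    u bound | yes (a , d) =
      ⊥-elim (ℕP.1+n≢0 (ℕP.n≤0⇒n≡0 (ℕP.≤-trans (ℕP.≤-reflexive (drop-letter u a d)) bound)))
    shortest-word-below (suc b) u bound | yes (a , d) =
      prepend-letter u a (drop-letter u a d)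
        (shortest-word-below b (a ∷ u) (drop-two (ℕP.≤-trans (ℕP.≤-reflexive (drop-letter u a d)) bound)))

  shortest-word : ∀ u → ShortWordFor u
  shortest-word u = shortest-word-below _ u ℕP.≤-refl

  evalWord⁻¹-represents : ∀ {u π} → (∀ j → evalWord⁻¹ u j ≡ π j) → Represents N (reverse u) π
  evalWord⁻¹-represents {u} eq j = trans (sym (evalWord⁻¹≗evalWord-reverse u j)) (eq j)

  represents⇒evalWord⁻¹ : ∀ {w π} → Represents N w π → ∀ j → evalWord⁻¹ (reverse w) j ≡ π j
  represents⇒evalWord⁻¹ {w} rep j = begin
    evalWord⁻¹ (reverse w) j              ≡⟨ evalWord⁻¹≗evalWord-reverse (reverse w) j ⟩
    evalWord N (reverse (reverse w)) j    ≡⟨ cong (λ u → evalWord N u j) (ListP.reverse-involutive w) ⟩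
    evalWord N w j                        ≡⟨ rep j ⟩
    _                                     ∎

  represents-periodic : ∀ {w π} → Represents N w π → Periodic π
  represents-periodic {w} {π} rep j = begin
    π (j + + N)                            ≡⟨ sym (represents⇒evalWord⁻¹ {w} rep _) ⟩
    evalWord⁻¹ (reverse w) (j + + N)       ≡⟨ evalWord⁻¹-periodic (reverse w) j ⟩
    evalWord⁻¹ (reverse w) j + + N         ≡⟨ cong (_+ + N) (represents⇒evalWord⁻¹ {w} rep j) ⟩
    π j + + N                              ∎

  represents-injective : ∀ {w π} → Represents N w π → Injective π
  represents-injective {w} rep a b eq = evalWord⁻¹-injective (reverse w) a b
    (trans (represents⇒evalWord⁻¹ {w} rep a) (trans eq (sym (represents⇒evalWord⁻¹ {w} rep b))))

  represents-inverse : ∀ {w π ρ} → Represents N w π → (∀ j → ρ (π j) ≡ j) → Represents N (reverse w) ρ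
  represents-inverse {w} {π} {ρ} rep ρ∘π j = begin
    evalWord N (reverse w) j              ≡⟨ sym (evalWord⁻¹≗evalWord-reverse w j) ⟩
    evalWord⁻¹ w j                        ≡⟨ sym (ρ∘π _) ⟩
    ρ (π (evalWord⁻¹ w j))                ≡⟨ cong ρ (sym (rep _)) ⟩
    ρ (evalWord N w (evalWord⁻¹ w j))     ≡⟨ cong ρ (evalWord⁻¹-inverseʳ w j) ⟩
    ρ j                                   ∎

  represents-∘s : ∀ {w π} → Represents N w π → ∀ a i → (∀ j → s N (letterIndex a) j ≡ s N i j) →
                  Represents N (w ++ [ a ]) (λ j → π (s N i j))
  represents-∘s {w} {π} rep a i s-a j = begin
    evalWord N (w ++ [ a ]) j             ≡⟨ evalWord-++ w [ a ] j ⟩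
    evalWord N w (s N (letterIndex a) j)  ≡⟨ rep (s N (letterIndex a) j) ⟩
    π (s N (letterIndex a) j)             ≡⟨ cong π (s-a j) ⟩
    π (s N i j)                           ∎

  private
    half-≤ : ∀ a b → a ℕ.+ a ℕ.≤ b ℕ.+ b → a ℕ.≤ b
    half-≤ a b h = ℕP.≮⇒≥ (λ b<a → ℕP.<-irrefl refl (ℕP.<-≤-trans (ℕP.+-mono-< b<a b<a) h))

    half-≡ : ∀ a b → a ℕ.+ a ≡ b ℕ.+ b → a ≡ b
    half-≡ a b e = ℕP.≤-antisym (half-≤ a b (ℕP.≤-reflexive e)) (half-≤ b a (ℕP.≤-reflexive (sym e)))

    halve-2+ : ∀ {x k} → 2 ℕ.+ x ≡ k ℕ.+ k → Σ ℕ λ k′ → k ≡ suc k′ × x ≡ k′ ℕ.+ k′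
    halve-2+ {k = zero}   ()
    halve-2+ {k = suc k′} e = k′ , refl , ℕP.suc-injective (trans (ℕP.suc-injective e) (ℕP.+-suc k′ k′))

  inversions-≤-word : ∀ {w π} → Represents N w π → inversions π ℕ.≤ length w ℕ.+ length w
  inversions-≤-word {w} {π} rep = subst₂ ℕ._≤_ (inversions-cong (represents⇒evalWord⁻¹ {w} rep))
    (cong (λ n → n ℕ.+ n) (ListP.length-reverse w)) (inversions-evalWord⁻¹-≤ (reverse w))

  shortest-representing-word : ∀ {w π} → Represents N w π →
                               Σ (List (Fin N)) λ w′ → Represents N w′ π × inversions π ≡ length w′ ℕ.+ length w′
  shortest-representing-word {w} {π} rep =
    let u′ , u′≗ , inversions≡ = shortest-word (reverse w) in
    reverse u′ ,
    evalWord⁻¹-represents {u′} (λ j → trans (u′≗ j) (represents⇒evalWord⁻¹ {w} rep j)) ,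
    trans (sym (inversions-cong (represents⇒evalWord⁻¹ {w} rep))) (trans inversions≡ (cong (λ n → n ℕ.+ n) (sym (ListP.length-reverse u′))))

  HasLength⇒inversions : ∀ {π k} → HasLength N π k → inversions π ≡ k ℕ.+ k
  HasLength⇒inversions ((w , rep , refl) , minimal) =
    let w′ , rep′ , inversions≡ = shortest-representing-word {w} rep in
    ℕP.≤-antisym (inversions-≤-word {w} rep)
      (subst (length w ℕ.+ length w ℕ.≤_) (sym inversions≡) (ℕP.+-mono-≤ (minimal w′ rep′) (minimal w′ rep′)))

  inversions⇒HasLength : ∀ {w π k} → Represents N w π → inversions π ≡ k ℕ.+ k → HasLength N π k
  inversions⇒HasLength {w} rep inversions≡ =
    let w′ , rep′ , inversions≡′ = shortest-representing-word {w} rep in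
    (w′ , rep′ , half-≡ _ _ (trans (sym inversions≡′) inversions≡)) ,
    λ w″ rep″ → half-≤ _ _ (subst (ℕ._≤ _) inversions≡ (inversions-≤-word {w″} rep″))

  HasLength-cong : ∀ {π π′ k} → (∀ j → π j ≡ π′ j) → HasLength N π k → HasLength N π′ k
  HasLength-cong π≗π′ ((w , rep , |w|) , minimal) =
    (w , (λ j → trans (rep j) (π≗π′ j)) , |w|) , λ w′ rep′ → minimal w′ (λ j → trans (rep′ j) (sym (π≗π′ j)))

  length-inverse : ∀ {π ρ k} → HasLength N π k → (∀ j → ρ (π j) ≡ j) → (∀ j → π (ρ j) ≡ j) → HasLength N ρ k
  length-inverse {k = k} ((w , rep , |w|) , minimal) ρ∘π π∘ρ =
    (reverse w , represents-inverse {w} rep ρ∘π , trans (ListP.length-reverse w) |w|) ,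
    λ w′ rep′ → subst (k ℕ.≤_) (ListP.length-reverse w′) (minimal (reverse w′) (represents-inverse {w′} rep′ π∘ρ))

  length-∘s-ascent : ∀ {π k} → HasLength N π k → ∀ i → π i < π (i + + 1) → HasLength N (λ j → π (s N i j)) (suc k)
  length-∘s-ascent {π} {k} length@((w , rep , _) , _) i ascent =
    inversions⇒HasLength {w ++ [ a ]} (represents-∘s {w} rep a i s-a) (begin
      inversions (λ j → π (s N i j))  ≡⟨ inversions-∘s-ascent {π} (represents-periodic {w} rep) (represents-injective {w} rep) i ascent ⟩
      2 ℕ.+ inversions π              ≡⟨ cong (2 ℕ.+_) (HasLength⇒inversions length) ⟩
      2 ℕ.+ (k ℕ.+ k)                 ≡⟨ cong suc (sym (ℕP.+-suc k k)) ⟩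
      suc k ℕ.+ suc k                 ∎)
    where
    a : Fin N
    a = proj₁ (letter-for i)
    s-a : ∀ j → s N (letterIndex a) j ≡ s N i j
    s-a = proj₂ (letter-for i)

  length-∘s-descent : ∀ {π k} → HasLength N π k → ∀ i → π (i + + 1) < π i →
                      Σ ℕ λ k′ → k ≡ suc k′ × HasLength N (λ j → π (s N i j)) k′
  length-∘s-descent {π} length@((w , rep , _) , _) i descent =
    let k′ , k≡ , inversions≡ = halve-2+ (trans (inversions-∘s-descent {π} (represents-periodic {w} rep) (represents-injective {w} rep) i descent)
                                                (HasLength⇒inversions length))
    in k′ , k≡ , inversions⇒HasLength {w ++ [ a ]} (represents-∘s {w} rep a i s-a) inversions≡
    where
    a : Fin N
    a = proj₁ (letter-for i)
    s-a : ∀ j → s N (letterIndex a) j ≡ s N i j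
    s-a = proj₂ (letter-for i)

  -- Involutions

  opposite-multiples : ∀ c q → c + q * + N ≡ c - q * + N → q ≡ + 0
  opposite-multiples c q eq = self-negating q (ℤP.*-cancelʳ-≡ q (- q) (+ N) (begin
    q * + N                   ≡⟨ solve (c ∷ q ∷ []) ⟩
    (c + q * + N) - c         ≡⟨ cong (_- c) eq ⟩
    (c - q * + N) - c         ≡⟨ solve (c ∷ q ∷ []) ⟩
    - q * + N                 ∎))

  module _ {z : ℤ → ℤ} (z-periodic : Periodic z) (z-involutive : ∀ j → z (z j) ≡ j) where

    image-swap : ∀ {a b} q → z a ≡ b + q * + N → z b ≡ a - q * + N
    image-swap {a} {b} q eq = begin
      z b                         ≡⟨ add-sub (z b) (q * + N) ⟩
      z b + q * + N - q * + N     ≡⟨ cong (_- q * + N) (sym (periodic-+-multiple {z} z-periodic b q)) ⟩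
      z (b + q * + N) - q * + N   ≡⟨ cong (λ x → z x - q * + N) (sym eq) ⟩
      z (z a) - q * + N           ≡⟨ cong (_- q * + N) (z-involutive a) ⟩
      a - q * + N                 ∎
      where
      add-sub : ∀ x d → x ≡ x + d - d
      add-sub = solve-∀

    fixed-point-free⇒no-fixed-residue : (∀ j → z j ≢ j) → ∀ i q → z i ≢ at i 0 q
    fixed-point-free⇒no-fixed-residue fpf i q eq = fpf i (trans eq (trans (cong (at i 0) q≡0) (at-origin i)))
      where
      z-i : z i ≡ i + q * + N
      z-i = trans eq (cong (_+ q * + N) (ℤP.+-identityʳ i))
      q≡0 : q ≡ + 0
      q≡0 = opposite-multiples i q (trans (sym z-i) (image-swap q z-i))

    ascent-preserved : (∀ j → z j ≢ j) → ∀ i → z i < z (i + + 1) → s N i (z i) < s N i (z (i + + 1))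
    ascent-preserved fpf i ascent = s-monotone i ascent (λ q eq _ → fixed-point-free⇒no-fixed-residue fpf i q eq)

    descent-preserved : ∀ i → z (i + + 1) < z i → z (i + + 1) ≢ i → s N i (z (i + + 1)) < s N i (z i)
    descent-preserved i descent z[i+1]≢i = s-monotone i descent exception
      where
      exception : ∀ q → z (i + + 1) ≡ at i 0 q → z i ≢ z (i + + 1) + + 1
      exception q eq₁ eq₂ = z[i+1]≢i (trans eq₁ (trans (cong (at i 0) q≡0) (at-origin i)))
        where
        z-i+1 : z (i + + 1) ≡ i + q * + N
        z-i+1 = trans eq₁ (cong (_+ q * + N) (ℤP.+-identityʳ i))
        reorder : ∀ i d → i + d + + 1 ≡ i + + 1 + d
        reorder = solve-∀
        q≡0 : q ≡ + 0
        q≡0 = opposite-multiples (i + + 1) q (begin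
          i + + 1 + q * + N       ≡⟨ sym (reorder i (q * + N)) ⟩
          i + q * + N + + 1       ≡⟨ cong (_+ + 1) (sym z-i+1) ⟩
          z (i + + 1) + + 1       ≡⟨ sym eq₂ ⟩
          z i                     ≡⟨ image-swap q z-i+1 ⟩
          i + + 1 - q * + N       ∎)

    module _ (i : ℤ) (z-i : z i ≡ i + + 1) where
      private
        z-at0 : ∀ q → z (at i 0 q) ≡ at i 1 q
        z-at0 q = trans (periodic-+-multiple {z} z-periodic (i + + 0) q) (cong (_+ q * + N) (trans (cong z (ℤP.+-identityʳ i)) z-i))

        z-at1 : ∀ q → z (at i 1 q) ≡ at i 0 q
        z-at1 q = trans (periodic-+-multiple {z} z-periodic (i + + 1) q)
                    (cong (_+ q * + N) (trans (trans (cong z (sym z-i)) (z-involutive i)) (sym (ℤP.+-identityʳ i))))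

        s-fixes-image : ∀ t q → suc (suc t) ℕ.< N → (o : Offset i (z (at i (suc (suc t)) q))) →
                        s N i (z (at i (suc (suc t)) q)) ≡ z (at i (suc (suc t)) q)
        s-fixes-image t q r<N (offset0 q′ eq) = ⊥-elim (ℕP.1+n≢0 (ℕP.suc-injective
          (at-offset-unique i {q = q} {q′} r<N 1<N (trans (sym (z-involutive _)) (trans (cong z eq) (z-at0 q′))))))
        s-fixes-image t q r<N (offset1 q′ eq) = ⊥-elim (ℕP.1+n≢0
          (at-offset-unique i {q = q} {q′} r<N 0<N (trans (sym (z-involutive _)) (trans (cong z eq) (z-at1 q′)))))
        s-fixes-image t q r<N (offset2+ t′ q′ r′<N eq) = trans (cong (s N i) eq) (trans (s-at2+ i t′ q′ r′<N) (sym eq))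

      conj-fixed : ∀ j → conj N i z j ≡ z j
      conj-fixed j with offset i j
      ... | offset0 q refl = begin
        s N i (z (s N i (at i 0 q)))   ≡⟨ cong (λ x → s N i (z x)) (s-at0 i q) ⟩
        s N i (z (at i 1 q))           ≡⟨ cong (s N i) (z-at1 q) ⟩
        s N i (at i 0 q)               ≡⟨ s-at0 i q ⟩
        at i 1 q                       ≡⟨ sym (z-at0 q) ⟩
        z (at i 0 q)                   ∎
      ... | offset1 q refl = begin
        s N i (z (s N i (at i 1 q)))   ≡⟨ cong (λ x → s N i (z x)) (s-at1 i q) ⟩
        s N i (z (at i 0 q))           ≡⟨ cong (s N i) (z-at0 q) ⟩
        s N i (at i 1 q)               ≡⟨ s-at1 i q ⟩
        at i 0 q                       ≡⟨ sym (z-at1 q) ⟩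
        z (at i 1 q)                   ∎
      ... | offset2+ t q r<N refl =
        trans (cong (λ x → s N i (z x)) (s-at2+ i t q r<N)) (s-fixes-image t q r<N (offset i _))

    private
      s∘z-inverts-z∘s : ∀ i j → s N i (z (z (s N i j))) ≡ j
      s∘z-inverts-z∘s i j = trans (cong (s N i) (z-involutive _)) (s-involutive i j)

      z∘s-inverts-s∘z : ∀ i j → z (s N i (s N i (z j))) ≡ j
      z∘s-inverts-s∘z i j = trans (cong z (s-involutive i (z j))) (z-involutive j)

    conj-length-ascent : (∀ j → z j ≢ j) → ∀ {k} i → HasLength N z k → z i < z (i + + 1) →
                         HasLength N (conj N i z) (suc (suc k))
    conj-length-ascent fpf i length ascent =
      length-∘s-ascent (length-inverse {ρ = λ j → s N i (z j)} (length-∘s-ascent length i ascent) (s∘z-inverts-z∘s i) (z∘s-inverts-s∘z i))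
                       i (ascent-preserved fpf i ascent)

    conj-length-descent : ∀ {k} i → HasLength N z k → z (i + + 1) < z i → z (i + + 1) ≢ i →
                          Σ ℕ λ k′ → k ≡ suc (suc k′) × HasLength N (conj N i z) k′
    conj-length-descent i length descent z[i+1]≢i =
      let k₁ , k≡ , length₁ = length-∘s-descent length i descent
          k₂ , k₁≡ , length₂ = length-∘s-descent (length-inverse {ρ = λ j → s N i (z j)} length₁ (s∘z-inverts-z∘s i) (z∘s-inverts-s∘z i))
                                                 i (descent-preserved i descent z[i+1]≢i)
      in k₂ , trans k≡ (cong suc k₁≡) , length₂

doubling-shift : ∀ q x c y → q Q.* (+ 2 Q./ 1) Q.≃ x Q./ 1 → x + + 2 * c ≡ y →
                 (q Q.+ c Q./ 1) Q.* (+ 2 Q./ 1) Q.≃ y Q./ 1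
doubling-shift (Q.mkℚᵘ a b) x c _ (Q.*≡* e) refl = Q.*≡* (begin
  (a * + 1 + c * + suc b) * + 2 * + 1       ≡⟨ shift a c (+ suc b) x (trans e (cong (λ n → x * + suc n) (ℕP.*-identityʳ b))) ⟩
  (x + + 2 * c) * + suc b                   ≡⟨ cong (λ n → (x + + 2 * c) * + suc n) (sym (trans (ℕP.*-identityʳ _) (ℕP.*-identityʳ b))) ⟩
  (x + + 2 * c) * + suc ((b ℕ.* 1) ℕ.* 1)   ∎)
  where
  shift : ∀ a c d x → a * + 2 * + 1 ≡ x * d → (a * + 1 + c * d) * + 2 * + 1 ≡ (x + + 2 * c) * d
  shift a c d x e = begin
    (a * + 1 + c * d) * + 2 * + 1   ≡⟨ solve (a ∷ c ∷ d ∷ []) ⟩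
    a * + 2 * + 1 + + 2 * c * d     ≡⟨ cong (λ y → y + + 2 * c * d) e ⟩
    x * d + + 2 * c * d             ≡⟨ solve (x ∷ c ∷ d ∷ []) ⟩
    (x + + 2 * c) * d               ∎

corollary3p16 : (n : ℕ) → 2 ℕ.≤ n → Σ ℕ (λ m → n ≡ 2 ℕ.* m) →
    (z : ℤ → ℤ) → IsFPFInvolution n z → (i : ℤ) → (q : Q.ℚᵘ) → HasFPFLength n z q →
      ((z (i + + 1) ℤ.< z i × z (i + + 1) ≢ i) → HasFPFLength n (conj n i z) (q Q.- Q.1ℚᵘ))
      × (z i ≡ i + + 1 → HasFPFLength n (conj n i z) q)
      × (z i ℤ.< z (i + + 1) → HasFPFLength n (conj n i z) (q Q.+ Q.1ℚᵘ))
corollary3p16 (suc (suc m)) (ℕ.s≤s (ℕ.s≤s ℕ.z≤n)) _ z (affine , involution) i q (k , length , q≃) = descent , swap , ascent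
  where
  open AffineSymmetric m
  z-periodic : Periodic z
  z-periodic = IsAffinePerm.periodic affine
  z-involutive : ∀ j → z (z j) ≡ j
  z-involutive j = proj₁ (involution j)
  h : ℤ
  h = + (N ℕ./ 2)

  descent : z (i + + 1) < z i × z (i + + 1) ≢ i → HasFPFLength N (conj N i z) (q Q.- Q.1ℚᵘ)
  descent (z[i+1]<z[i] , z[i+1]≢i) =
    let k′ , k≡ , length′ = conj-length-descent z-periodic z-involutive i length z[i+1]<z[i] z[i+1]≢i
    in k′ , length′ , doubling-shift q (+ k - h) (- + 1) (+ k′ - h) q≃ (trans (cong (λ n → + n - h + + 2 * - + 1) k≡) (cancel (+ k′) h))
    where
    cancel : ∀ K H → (+ 2 + K - H) + + 2 * - + 1 ≡ K - H
    cancel = solve-∀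

  swap : z i ≡ i + + 1 → HasFPFLength N (conj N i z) q
  swap z-i = k , HasLength-cong (λ j → sym (conj-fixed z-periodic z-involutive i z-i j)) length , q≃

  ascent : z i < z (i + + 1) → HasFPFLength N (conj N i z) (q Q.+ Q.1ℚᵘ)
  ascent z[i]<z[i+1] = suc (suc k) , conj-length-ascent z-periodic z-involutive (λ j → proj₂ (involution j)) i length z[i]<z[i+1] ,
    doubling-shift q (+ k - h) (+ 1) (+ suc (suc k) - h) q≃ (regroup (+ k) h)
    where
    regroup : ∀ K H → K - H + + 2 * + 1 ≡ (+ 2 + K) - H
    regroup = solve-∀
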